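{- For all integers $k\ge2$ and $n\ge2k+1$ there exists an integer $q_0(n,k)$ such that for every integer $q\ge q_0(n,k)+1$ and every integer $0\le r\le k-1$, $$\chi_{qk-r}(K(n,k))\ge n+\chi_{(q-1)k-r}(K(n,k)).$$
   Context: For integers $n\ge k\ge 1$, the Kneser graph $K(n,k)$ has as vertices all $k$-element subsets of $[n]=\{1,\dots,n\}$, two vertices being adjacent iff the subsets are disjoint. A graph $G$ is $(n,k)$-colourable if each vertex can be assigned a $k$-subset of $[n]$ so that adjacent vertices receive disjoint subsets. The $k$-th multi-chromatic number $\chi_k(G)$ is the smallest $n$ such that $G$ is $(n,k)$-colourable. -}

module Defs where

open import Data.Nat using (ℕ; _≤_)
open import Data.Fin using (Fin)
open import Data.Fin.Subset using (Subset; _∈_; ∣_∣)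
open import Data.Product using (Σ; _×_)
open import Data.Empty using (⊥)
open import Relation.Binary.PropositionalEquality using (_≡_)

Disjoint : {n : ℕ} → Subset n → Subset n → Set
Disjoint {n} s t = (i : Fin n) → i ∈ s → i ∈ t → ⊥

KSubset : ℕ → ℕ → Set
KSubset n k = Σ (Subset n) (λ s → ∣ s ∣ ≡ k)

KVertex : ℕ → ℕ → Set
KVertex n k = KSubset n k

KAdj : {n k : ℕ} → KVertex n k → KVertex n k → Set
KAdj u v = Disjoint (Σ.proj₁ u) (Σ.proj₁ v)

Colourable : (V : Set) → (V → V → Set) → ℕ → ℕ → Set
Colourable V E m j =
  Σ (V → KSubset m j) (λ c → (u v : V) → E u v → Disjoint (Σ.proj₁ (c u)) (Σ.proj₁ (c v)))

IsMultiChromatic : (V : Set) → (V → V → Set) → ℕ → ℕ → Set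
IsMultiChromatic V E j χ =
  Colourable V E χ j × ((m : ℕ) → Colourable V E m j → χ ≤ m)

module Submission where

-- Let c be an (m , j)-colouring of K(n , k) with j = q k − r and m ≤ q n.  By Katona's
-- circle argument, for every cyclic order of [n] a colour lies on at most k of the n windows
-- (arcs of k consecutive elements), and on exactly k only if they are consecutive; as the
-- windows carry n j colours in total, at most n r colours fall short of k for each order.
-- A colour that reaches k for the identity order and for n 2ⁿ further orders, one adapted to
-- each pair (y , A), has as colour class the star of some y.  Counting colours on k-sets shows
-- that, once j exceeds a bound independent of q, every y ∈ [n] has such a star colour.
-- Deleting one star colour per y leaves an (m − n , j − k)-colouring.

open import Defs
open import Data.Nat using (ℕ; _+_; _*_; _∸_; _≤_; _<_)
open import Data.Product using (Σ)

open import Data.Nat.Properties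
open import Algebra.Properties.Semiring.Sum +-*-semiring
  using (sum; sum-syntax; ∑-distrib-+; ∑-comm; *-distribˡ-sum; *-distribʳ-sum; sum-cong-≗)
open import Data.Bool.Base using (if_then_else_)
open import Data.Empty using (⊥; ⊥-elim)
open import Data.Fin.Base using (Fin; zero; suc; toℕ; fromℕ<)
open import Data.Fin.Properties using (toℕ<n; toℕ-fromℕ<; toℕ-injective; any?) renaming (_≟_ to _≟ᶠ_)
open import Data.Fin.Subset using (Subset; inside; outside; _∈_; _∉_; _⊆_; ∣_∣; ∁; ⁅_⁆)
open import Data.Fin.Subset.Properties
  using (_∈?_; ∣p∣≤n; ⊆-antisym; p⊂q⇒∣p∣<∣q∣; x∈∁p⇒x∉p; x∉p⇒x∈∁p; ∣∁p∣≡n∸∣p∣; x∈⁅x⁆; x∈⁅y⁆⇒x≡y; ∣⁅x⁆∣≡1)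
open import Data.List.Base using (List; []; _∷_; _++_; length; filter; applyUpTo)
open import Data.List.Membership.Propositional using () renaming (_∈_ to _∈ₗ_; _∉_ to _∉ₗ_)
open import Data.List.Membership.Propositional.Properties
  using (∈-++⁺ˡ; ∈-++⁺ʳ; ∈-++⁻; ∈-filter⁺; ∈-filter⁻; ∈-applyUpTo⁺; ∈-applyUpTo⁻)
open import Data.List.Properties using (length-++; length-applyUpTo)
import Data.List.Relation.Unary.All as All
open import Data.List.Relation.Unary.AllPairs using (_∷_)
import Data.List.Relation.Unary.Any as Any
open import Data.List.Relation.Unary.Unique.Propositional using (Unique)
import Data.List.Relation.Unary.Unique.Propositional.Properties as Unique
open import Data.Nat.Base using (zero; suc; z≤n; s≤s; s≤s⁻¹; NonZero; >-nonZero; _^_)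
open import Data.Nat.DivMod
  using (_%_; _mod_; %-distribˡ-+; m<n⇒m%n≡m; m%n<n; m≤n⇒[n∸m]%m≡n%m; m%n%n≡m%n; [m+n]%n≡m%n)
open import Data.Nat.Tactic.RingSolver using (solve-∀)
open import Data.Product.Base using (_,_; proj₁; proj₂; ∃-syntax; _×_)
open import Data.Sum.Base using (_⊎_; inj₁; inj₂)
open import Data.Vec.Base using ([]; _∷_; here; there)
import Data.Vec.Base as Vec
open import Function.Base using (_∘_)
open import Function.Definitions using (Injective)
open import Level using (0ℓ)
open import Relation.Binary.Definitions using (tri<; tri≈; tri>)
open import Relation.Binary.PropositionalEquality
open import Relation.Nullary.Decidable.Core using (Dec; yes; no; does; ¬?; _×-dec_; _⊎-dec_)
open import Relation.Nullary.Negation.Core using (¬_; contradiction)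
open import Relation.Unary using (Pred; Decidable)

private
  variable
    a : ℕ

-- Finite sums

𝟙 : {P : Set} → Dec P → ℕ
𝟙 P? = if does P? then 1 else 0

𝟙-yes : {P : Set} (P? : Dec P) → P → 𝟙 P? ≡ 1
𝟙-yes (yes _) _ = refl
𝟙-yes (no ¬p) p = contradiction p ¬p

𝟙-no : {P : Set} (P? : Dec P) → ¬ P → 𝟙 P? ≡ 0
𝟙-no (yes p) ¬p = contradiction p ¬p
𝟙-no (no _) _ = refl

𝟙≤1 : {P : Set} (P? : Dec P) → 𝟙 P? ≤ 1
𝟙≤1 (yes _) = ≤-refl
𝟙≤1 (no _) = z≤n

𝟙-cong : {P Q : Set} (P? : Dec P) (Q? : Dec Q) → (P → Q) → (Q → P) → 𝟙 P? ≡ 𝟙 Q?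
𝟙-cong (yes _) (yes _) _ _ = refl
𝟙-cong (no _) (no _) _ _ = refl
𝟙-cong (yes p) (no ¬q) p→q _ = contradiction (p→q p) ¬q
𝟙-cong (no ¬p) (yes q) _ q→p = contradiction (q→p q) ¬p

𝟙-exclusive : {P Q : Set} (P? : Dec P) (Q? : Dec Q) → (P → Q → ⊥) → 𝟙 P? + 𝟙 Q? ≤ 1
𝟙-exclusive (yes p) (yes q) ¬pq = contradiction q (¬pq p)
𝟙-exclusive (yes _) (no _) _ = ≤-refl
𝟙-exclusive (no _) Q? _ = 𝟙≤1 Q?

𝟙-positive : {P : Set} (P? : Dec P) → 0 < 𝟙 P? → P
𝟙-positive (yes p) _ = p

sum-mono-≤ : {f g : Fin a → ℕ} → (∀ i → f i ≤ g i) → sum f ≤ sum g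
sum-mono-≤ {zero} f≤g = z≤n
sum-mono-≤ {suc a} f≤g = +-mono-≤ (f≤g zero) (sum-mono-≤ (f≤g ∘ suc))

sum-const : ∀ a c → ∑[ i < a ] c ≡ a * c
sum-const zero c = refl
sum-const (suc a) c = cong (c +_) (sum-const a c)

sum-zero : (f : Fin a → ℕ) → (∀ i → f i ≡ 0) → sum f ≡ 0
sum-zero {a} f f≡0 = trans (sum-cong-≗ {a} f≡0) (trans (sum-const a 0) (*-zeroʳ a))

term≤sum : (f : Fin a → ℕ) (i : Fin a) → f i ≤ sum f
term≤sum f zero = m≤m+n _ _
term≤sum f (suc i) = ≤-trans (term≤sum (λ j → f (suc j)) i) (m≤n+m _ _)

sum-single : (f : Fin a → ℕ) (i : Fin a) → (∀ j → j ≢ i → f j ≡ 0) → sum f ≡ f i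
sum-single {suc a} f zero others = trans (cong (f zero +_) (sum-zero (f ∘ suc) (λ j → others (suc j) λ ()))) (+-identityʳ _)
sum-single {suc a} f (suc i) others =
  trans (cong (_+ ∑[ j < a ] f (suc j)) (others zero λ ()))
        (sum-single (λ j → f (suc j)) i (λ j j≢i → others (suc j) (λ where refl → j≢i refl)))

positive-term : (f : Fin a → ℕ) → 0 < sum f → ∃[ i ] 0 < f i
positive-term {suc a} f 0<sum with f zero in eq
... | suc _ = zero , subst (0 <_) (sym eq) (s≤s z≤n)
... | zero with positive-term (λ j → f (suc j)) 0<sum
...   | i , 0<fi = suc i , 0<fi

all-one : (f : Fin a → ℕ) → (∀ i → f i ≤ 1) → a ≤ sum f → ∀ i → f i ≡ 1
all-one {suc a} f f≤1 a≤sum zero = ≤-antisym (f≤1 zero) (+-cancelʳ-≤ _ 1 (f zero) (begin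
  1 + ∑[ j < a ] f (suc j) ≤⟨ +-monoʳ-≤ 1 rest≤a ⟩
  1 + a                    ≤⟨ a≤sum ⟩
  f zero + ∑[ j < a ] f (suc j) ∎))
  where
  open ≤-Reasoning
  rest≤a : ∑[ j < a ] f (suc j) ≤ a
  rest≤a = ≤-trans (sum-mono-≤ (λ j → f≤1 (suc j))) (≤-reflexive (trans (sum-const a 1) (*-identityʳ a)))
all-one {suc a} f f≤1 a≤sum (suc i) =
  all-one (λ j → f (suc j)) (λ j → f≤1 (suc j)) (+-cancelˡ-≤ 1 _ _ (≤-trans a≤sum (+-monoˡ-≤ _ (f≤1 zero)))) i

zero-term : (f : Fin a → ℕ) → (∀ i → f i ≤ 1) → sum f < a → ∃[ i ] f i ≡ 0
zero-term {a} f f≤1 sum<a with any? (λ i → f i ≟ 0)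
... | yes found = found
... | no none = contradiction (≤-reflexive (sym sum≡a)) (<⇒≱ sum<a)
  where
  sum≡a : sum f ≡ a
  sum≡a = begin
    sum f          ≡⟨ sum-cong-≗ {a} (λ i → ≤-antisym (f≤1 i) (n≢0⇒n>0 (λ fi≡0 → none (i , fi≡0)))) ⟩
    ∑[ i < a ] 1   ≡⟨ sum-const a 1 ⟩
    a * 1          ≡⟨ *-identityʳ a ⟩
    a              ∎
    where open ≡-Reasoning

rangeSum : ℕ → (ℕ → ℕ) → ℕ
rangeSum a f = ∑[ i < a ] f (toℕ i)

syntax rangeSum a (λ d → e) = ∑ℕ[ d < a ] e

rangeSum-split : ∀ a b (f : ℕ → ℕ) → ∑ℕ[ d < a + b ] f d ≡ ∑ℕ[ d < a ] f d + ∑ℕ[ d < b ] f (a + d)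
rangeSum-split zero b f = refl
rangeSum-split (suc a) b f = trans (cong (f 0 +_) (rangeSum-split a b (f ∘ suc))) (sym (+-assoc (f 0) _ _))

rangeSum-rotate : ∀ a (f : ℕ → ℕ) → f a ≡ f 0 → ∑ℕ[ d < a ] f (suc d) ≡ ∑ℕ[ d < a ] f d
rangeSum-rotate zero f _ = refl
rangeSum-rotate (suc a) f fa≡f0 = begin
  ∑ℕ[ d < suc a ] f (suc d)           ≡⟨ cong (λ b → rangeSum b (f ∘ suc)) (+-comm 1 a) ⟩
  ∑ℕ[ d < a + 1 ] f (suc d)           ≡⟨ rangeSum-split a 1 (f ∘ suc) ⟩
  ∑ℕ[ d < a ] f (suc d) + (f (suc (a + 0)) + 0) ≡⟨ cong (∑ℕ[ d < a ] f (suc d) +_) last≡ ⟩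
  ∑ℕ[ d < a ] f (suc d) + f 0         ≡⟨ +-comm _ (f 0) ⟩
  ∑ℕ[ d < suc a ] f d                 ∎
  where
  open ≡-Reasoning
  last≡ : f (suc (a + 0)) + 0 ≡ f 0
  last≡ = trans (+-identityʳ _) (trans (cong (f ∘ suc) (+-identityʳ a)) fa≡f0)

rangeSum-periodic : ∀ a (f : ℕ → ℕ) → (∀ s → f (s + a) ≡ f s) →
                    ∀ s → ∑ℕ[ d < a ] f (s + d) ≡ ∑ℕ[ d < a ] f d
rangeSum-periodic a f periodic zero = refl
rangeSum-periodic a f periodic (suc s) =
  begin
    ∑ℕ[ d < a ] f (suc s + d) ≡⟨ sum-cong-≗ {a} (λ i → cong f (sym (+-suc s (toℕ i)))) ⟩
    ∑ℕ[ d < a ] f (s + suc d) ≡⟨ rangeSum-rotate a (λ d → f (s + d)) (periodic' s) ⟩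
    ∑ℕ[ d < a ] f (s + d)     ≡⟨ rangeSum-periodic a f periodic s ⟩
    ∑ℕ[ d < a ] f d           ∎
  where
  open ≡-Reasoning
  periodic' : ∀ s → f (s + a) ≡ f (s + 0)
  periodic' s = trans (periodic s) (cong f (sym (+-identityʳ s)))

∑-subsets : ∀ {n} → (Subset n → ℕ) → ℕ
∑-subsets {zero} f = f []
∑-subsets {suc n} f = ∑-subsets (f ∘ (inside ∷_)) + ∑-subsets (f ∘ (outside ∷_))

term≤∑-subsets : ∀ {n} (f : Subset n → ℕ) (A : Subset n) → f A ≤ ∑-subsets f
term≤∑-subsets f [] = ≤-refl
term≤∑-subsets f (inside ∷ A) = ≤-trans (term≤∑-subsets (f ∘ (inside ∷_)) A) (m≤m+n _ _)
term≤∑-subsets f (outside ∷ A) = ≤-trans (term≤∑-subsets (f ∘ (outside ∷_)) A) (m≤n+m _ _)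

∑-subsets-mono-≤ : ∀ {n} {f g : Subset n → ℕ} → (∀ A → f A ≤ g A) → ∑-subsets f ≤ ∑-subsets g
∑-subsets-mono-≤ {zero} f≤g = f≤g []
∑-subsets-mono-≤ {suc n} f≤g = +-mono-≤ (∑-subsets-mono-≤ (f≤g ∘ (inside ∷_))) (∑-subsets-mono-≤ (f≤g ∘ (outside ∷_)))

∑-subsets-const : ∀ n c → ∑-subsets {n} (λ _ → c) ≡ 2 ^ n * c
∑-subsets-const zero c = sym (+-identityʳ c)
∑-subsets-const (suc n) c = begin
  ∑-subsets {n} (λ _ → c) + ∑-subsets {n} (λ _ → c) ≡⟨ cong₂ _+_ (∑-subsets-const n c) (∑-subsets-const n c) ⟩
  2 ^ n * c + 2 ^ n * c                             ≡⟨ cong (2 ^ n * c +_) (sym (+-identityʳ (2 ^ n * c))) ⟩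
  2 * (2 ^ n * c)                                   ≡⟨ sym (*-assoc 2 (2 ^ n) c) ⟩
  2 ^ suc n * c                                     ∎
  where open ≡-Reasoning

∑-∑-subsets-comm : ∀ {n} (f : Fin a → Subset n → ℕ) → ∑[ i < a ] ∑-subsets (f i) ≡ ∑-subsets (λ A → ∑[ i < a ] f i A)
∑-∑-subsets-comm {n = zero} f = refl
∑-∑-subsets-comm {n = suc n} f =
  trans (∑-distrib-+ (λ i → ∑-subsets (f i ∘ (inside ∷_))) (λ i → ∑-subsets (f i ∘ (outside ∷_))))
        (cong₂ _+_ (∑-∑-subsets-comm (λ i → f i ∘ (inside ∷_))) (∑-∑-subsets-comm (λ i → f i ∘ (outside ∷_))))

-- Arithmetic modulo n

module _ {n : ℕ} ⦃ _ : NonZero n ⦄ where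

  private
    remainder-step : ∀ {r e} → r < n → e < n → r ≡ (r + e) % n → e ≡ 0
    remainder-step {r} {e} r<n e<n eq with r + e <? n
    ... | yes r+e<n = sym (+-cancelˡ-≡ r 0 e (trans (+-identityʳ r) (trans eq (m<n⇒m%n≡m r+e<n))))
    ... | no r+e≮n = contradiction (sym n≡e) (<⇒≢ e<n)
      where
      n≤r+e = ≮⇒≥ r+e≮n
      r+e∸n<n : r + e ∸ n < n
      r+e∸n<n = subst (r + e ∸ n <_) (m+n∸n≡m n n) (∸-monoˡ-< (+-mono-< r<n e<n) n≤r+e)
      r≡r+e∸n : r ≡ r + e ∸ n
      r≡r+e∸n = trans eq (trans (sym (m≤n⇒[n∸m]%m≡n%m n≤r+e)) (m<n⇒m%n≡m r+e∸n<n))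
      n≡e : n ≡ e
      n≡e = +-cancelˡ-≡ r n e (trans (cong (_+ n) r≡r+e∸n) (m∸n+n≡m n≤r+e))

  %-step-injective : ∀ x {e} → e < n → x % n ≡ (x + e) % n → e ≡ 0
  %-step-injective x {e} e<n eq = remainder-step (m%n<n x n) e<n (begin
    x % n               ≡⟨ eq ⟩
    (x + e) % n         ≡⟨ %-distribˡ-+ x e n ⟩
    (x % n + e % n) % n ≡⟨ cong (λ z → (x % n + z) % n) (m<n⇒m%n≡m e<n) ⟩
    (x % n + e) % n     ∎)
    where open ≡-Reasoning

  %-distinct-on-arc : ∀ s {t u} → t < u → u < n → (s + t) % n ≢ (s + u) % n
  %-distinct-on-arc s {t} {u} t<u u<n eq = <⇒≢ (m<n⇒0<n∸m t<u)
    (sym (%-step-injective (s + t) (≤-<-trans (m∸n≤m u t) u<n) (trans eq (cong (_% n) split))))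
    where
    split : s + u ≡ s + t + (u ∸ t)
    split = trans (cong (s +_) (sym (m+[n∸m]≡n (<⇒≤ t<u)))) (sym (+-assoc s t (u ∸ t)))

  %-injective-on-arc : ∀ s {t u} → t < n → u < n → (s + t) % n ≡ (s + u) % n → t ≡ u
  %-injective-on-arc s {t} {u} t<n u<n eq with <-cmp t u
  ... | tri< t<u _ _ = contradiction eq (%-distinct-on-arc s t<u u<n)
  ... | tri≈ _ t≡u _ = t≡u
  ... | tri> _ _ u<t = contradiction (sym eq) (%-distinct-on-arc s u<t t<n)

-- Subsets and lists

private
  variable
    n : ℕ

⟦_⟧ : {P : Pred (Fin n) 0ℓ} → Decidable P → Subset n
⟦_⟧ {zero} P? = []
⟦_⟧ {suc n} P? = does (P? zero) ∷ ⟦ P? ∘ suc ⟧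

∈⟦⟧⁺ : {P : Pred (Fin n) 0ℓ} (P? : Decidable P) {x : Fin n} → P x → x ∈ ⟦ P? ⟧
∈⟦⟧⁺ P? {zero} p with P? zero
... | yes _ = here
... | no ¬p = contradiction p ¬p
∈⟦⟧⁺ P? {suc x} p = there (∈⟦⟧⁺ (P? ∘ suc) p)

∈⟦⟧⁻ : {P : Pred (Fin n) 0ℓ} (P? : Decidable P) {x : Fin n} → x ∈ ⟦ P? ⟧ → P x
∈⟦⟧⁻ P? {zero} x∈ with P? zero | x∈
... | yes p | _ = p
∈⟦⟧⁻ P? {suc x} (there x∈) = ∈⟦⟧⁻ (P? ∘ suc) x∈

∑∈ : Subset n → (Fin n → ℕ) → ℕ
∑∈ p g = sum (λ x → 𝟙 (x ∈? p) * g x)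

∣p∣≡∑𝟙∈ : (p : Subset n) → ∣ p ∣ ≡ ∑[ x < n ] 𝟙 (x ∈? p)
∣p∣≡∑𝟙∈ [] = refl
∣p∣≡∑𝟙∈ (inside ∷ p) = cong suc (∣p∣≡∑𝟙∈ p)
∣p∣≡∑𝟙∈ (outside ∷ p) = ∣p∣≡∑𝟙∈ p

𝟙-∈⟦⟧ : {P : Pred (Fin n) 0ℓ} (P? : Decidable P) (x : Fin n) → 𝟙 (x ∈? ⟦ P? ⟧) ≡ 𝟙 (P? x)
𝟙-∈⟦⟧ P? x = 𝟙-cong (x ∈? ⟦ P? ⟧) (P? x) (∈⟦⟧⁻ P?) (∈⟦⟧⁺ P?)

∑∈-mono-≤ : (p : Subset n) {g h : Fin n → ℕ} → (∀ x → x ∈ p → g x ≤ h x) → ∑∈ p g ≤ ∑∈ p h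
∑∈-mono-≤ p {g} {h} g≤h = sum-mono-≤ term≤
  where
  term≤ : ∀ x → 𝟙 (x ∈? p) * g x ≤ 𝟙 (x ∈? p) * h x
  term≤ x with x ∈? p
  ... | yes x∈p = +-mono-≤ (g≤h x x∈p) z≤n
  ... | no _ = z≤n

∑∈-const : (p : Subset n) (c : ℕ) → ∑∈ p (λ _ → c) ≡ ∣ p ∣ * c
∑∈-const {n} p c = trans (sym (*-distribʳ-sum c (λ x → 𝟙 (x ∈? p)))) (cong (_* c) (sym (∣p∣≡∑𝟙∈ p)))

∑-point : (z : Fin n) (g : Fin n → ℕ) → ∑[ x < n ] (𝟙 (z ≟ᶠ x) * g x) ≡ g z
∑-point z g = trans (sum-single _ z others) (trans (cong (_* g z) (𝟙-yes (z ≟ᶠ z) refl)) (+-identityʳ (g z)))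
  where
  others : ∀ x → x ≢ z → 𝟙 (z ≟ᶠ x) * g x ≡ 0
  others x x≢z = cong (_* g x) (𝟙-no (z ≟ᶠ x) (x≢z ∘ sym))

image : (Fin a → Fin n) → Subset n
image f = ⟦ (λ x → any? (λ t → f t ≟ᶠ x)) ⟧

module _ (f : Fin a → Fin n) where

  ∈-image⁺ : ∀ t → f t ∈ image f
  ∈-image⁺ t = ∈⟦⟧⁺ (λ x → any? (λ t → f t ≟ᶠ x)) (t , refl)

  ∈-image⁻ : ∀ {x} → x ∈ image f → ∃[ t ] f t ≡ x
  ∈-image⁻ = ∈⟦⟧⁻ (λ x → any? (λ t → f t ≟ᶠ x))

  module _ (f-injective : Injective _≡_ _≡_ f) where

    𝟙-∈-image : ∀ x → 𝟙 (x ∈? image f) ≡ ∑[ t < a ] 𝟙 (f t ≟ᶠ x)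
    𝟙-∈-image x with x ∈? image f
    ... | yes x∈ = let (t₀ , ft₀≡x) = ∈-image⁻ x∈ in sym (begin
      ∑[ t < a ] 𝟙 (f t ≟ᶠ x) ≡⟨ sum-single _ t₀ (λ t t≢t₀ → 𝟙-no (f t ≟ᶠ x) (λ ft≡x → t≢t₀ (f-injective (trans ft≡x (sym ft₀≡x))))) ⟩
      𝟙 (f t₀ ≟ᶠ x)           ≡⟨ 𝟙-yes (f t₀ ≟ᶠ x) ft₀≡x ⟩
      1                       ∎)
      where open ≡-Reasoning
    ... | no x∉ = sym (sum-zero _ (λ t → 𝟙-no (f t ≟ᶠ x) (λ ft≡x → x∉ (subst (_∈ image f) ft≡x (∈-image⁺ t)))))

    ∑∈-image : (g : Fin n → ℕ) → ∑∈ (image f) g ≡ ∑[ t < a ] g (f t)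
    ∑∈-image g = begin
      ∑[ x < n ] (𝟙 (x ∈? image f) * g x)             ≡⟨ sum-cong-≗ {n} (λ x → cong (_* g x) (𝟙-∈-image x)) ⟩
      ∑[ x < n ] ((∑[ t < a ] 𝟙 (f t ≟ᶠ x)) * g x)   ≡⟨ sum-cong-≗ {n} (λ x → *-distribʳ-sum (g x) (λ t → 𝟙 (f t ≟ᶠ x))) ⟩
      ∑[ x < n ] ∑[ t < a ] (𝟙 (f t ≟ᶠ x) * g x)     ≡⟨ ∑-comm (λ x t → 𝟙 (f t ≟ᶠ x) * g x) ⟩
      ∑[ t < a ] ∑[ x < n ] (𝟙 (f t ≟ᶠ x) * g x)     ≡⟨ sum-cong-≗ {a} (λ t → ∑-point (f t) g) ⟩
      ∑[ t < a ] g (f t)                              ∎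
      where open ≡-Reasoning

    ∣image∣ : ∣ image f ∣ ≡ a
    ∣image∣ = begin
      ∣ image f ∣          ≡⟨ *-identityʳ _ ⟨
      ∣ image f ∣ * 1      ≡⟨ ∑∈-const (image f) 1 ⟨
      ∑∈ (image f) (λ _ → 1) ≡⟨ ∑∈-image (λ _ → 1) ⟩
      ∑[ t < a ] 1         ≡⟨ sum-const a 1 ⟩
      a * 1                ≡⟨ *-identityʳ a ⟩
      a                    ∎
      where open ≡-Reasoning

image-cong : {f g : Fin a → Fin n} → (∀ t → f t ≡ g t) → image f ≡ image g
image-cong {f = f} {g} f≗g = ⊆-antisym (transfer f g f≗g) (transfer g f (sym ∘ f≗g))
  where
  transfer : ∀ f g → (∀ t → f t ≡ g t) → image f ⊆ image g
  transfer f g f≗g x∈ = let (t , ft≡x) = ∈-image⁻ f x∈ in subst (_∈ image g) (trans (sym (f≗g t)) ft≡x) (∈-image⁺ g t)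

⊆∧∣∣≤⇒≡ : {p q : Subset n} → p ⊆ q → ∣ q ∣ ≤ ∣ p ∣ → p ≡ q
⊆∧∣∣≤⇒≡ {p = p} {q} p⊆q ∣q∣≤∣p∣ with any? (λ x → x ∈? q ×-dec ¬? (x ∈? p))
... | yes (x , x∈q , x∉p) = contradiction (p⊂q⇒∣p∣<∣q∣ (p⊆q , x , x∈q , x∉p)) (≤⇒≯ ∣q∣≤∣p∣)
... | no ∄x = ⊆-antisym p⊆q q⊆p
  where
  q⊆p : q ⊆ p
  q⊆p {x} x∈q with x ∈? p
  ... | yes x∈p = x∈p
  ... | no x∉p = contradiction (x , x∈q , x∉p) ∄x

vertex-≡ : ∀ {k} {u v : KSubset n k} → proj₁ u ≡ proj₁ v → u ≡ v
vertex-≡ {u = p , ∣p∣≡k} {.p , ∣p∣≡k′} refl = cong (p ,_) (≡-irrelevant ∣p∣≡k ∣p∣≡k′)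

shrinkTo : ℕ → Subset n → Subset n
shrinkTo t [] = []
shrinkTo zero (_ ∷ p) = outside ∷ shrinkTo zero p
shrinkTo (suc t) (inside ∷ p) = inside ∷ shrinkTo t p
shrinkTo (suc t) (outside ∷ p) = outside ∷ shrinkTo (suc t) p

shrinkTo-⊆ : ∀ t (p : Subset n) → shrinkTo t p ⊆ p
shrinkTo-⊆ zero (_ ∷ p) (there x∈) = there (shrinkTo-⊆ zero p x∈)
shrinkTo-⊆ (suc t) (inside ∷ p) here = here
shrinkTo-⊆ (suc t) (inside ∷ p) (there x∈) = there (shrinkTo-⊆ t p x∈)
shrinkTo-⊆ (suc t) (outside ∷ p) (there x∈) = there (shrinkTo-⊆ (suc t) p x∈)

∣shrinkTo∣ : ∀ t (p : Subset n) → t ≤ ∣ p ∣ → ∣ shrinkTo t p ∣ ≡ t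
∣shrinkTo∣ zero [] _ = refl
∣shrinkTo∣ zero (_ ∷ p) _ = ∣shrinkTo∣ zero p z≤n
∣shrinkTo∣ (suc t) (inside ∷ p) (s≤s t≤) = cong suc (∣shrinkTo∣ t p t≤)
∣shrinkTo∣ (suc t) (outside ∷ p) t≤ = ∣shrinkTo∣ (suc t) p t≤

remove : Fin n → Subset n → Subset n
remove x p = ⟦ (λ z → z ∈? p ×-dec ¬? (x ≟ᶠ z)) ⟧

insert : Fin n → Subset n → Subset n
insert x p = ⟦ (λ z → (x ≟ᶠ z) ⊎-dec (z ∈? p)) ⟧

𝟙-remove : {x : Fin n} {p : Subset n} → x ∈ p → ∀ z → 𝟙 (z ∈? remove x p) + 𝟙 (x ≟ᶠ z) ≡ 𝟙 (z ∈? p)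
𝟙-remove {x = x} {p} x∈p z rewrite 𝟙-∈⟦⟧ (λ z → z ∈? p ×-dec ¬? (x ≟ᶠ z)) z with z ∈? p | x ≟ᶠ z
... | yes _   | yes _    = refl
... | yes _   | no _     = refl
... | no z∉p  | yes refl = contradiction x∈p z∉p
... | no _    | no _     = refl

𝟙-insert : {x : Fin n} {p : Subset n} → x ∉ p → ∀ z → 𝟙 (z ∈? p) + 𝟙 (x ≟ᶠ z) ≡ 𝟙 (z ∈? insert x p)
𝟙-insert {x = x} {p} x∉p z rewrite 𝟙-∈⟦⟧ (λ z → (x ≟ᶠ z) ⊎-dec (z ∈? p)) z with x ≟ᶠ z | z ∈? p
... | yes refl | yes x∈p = contradiction x∈p x∉p
... | yes _    | no _    = refl
... | no _     | yes _   = refl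
... | no _     | no _    = refl

∑∈-split-point : {p q : Subset n} (a : Fin n) → (∀ z → 𝟙 (z ∈? p) + 𝟙 (a ≟ᶠ z) ≡ 𝟙 (z ∈? q)) →
                 (g : Fin n → ℕ) → ∑∈ p g + g a ≡ ∑∈ q g
∑∈-split-point {n} {p} {q} a 𝟙-split g = begin
  ∑∈ p g + g a                                       ≡⟨ cong (∑∈ p g +_) (∑-point a g) ⟨
  ∑∈ p g + ∑[ z < n ] (𝟙 (a ≟ᶠ z) * g z)             ≡⟨ ∑-distrib-+ (λ z → 𝟙 (z ∈? p) * g z) _ ⟨
  ∑[ z < n ] (𝟙 (z ∈? p) * g z + 𝟙 (a ≟ᶠ z) * g z)  ≡⟨ sum-cong-≗ {n} pointwise ⟩
  ∑∈ q g                                             ∎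
  where
  open ≡-Reasoning
  pointwise : ∀ z → 𝟙 (z ∈? p) * g z + 𝟙 (a ≟ᶠ z) * g z ≡ 𝟙 (z ∈? q) * g z
  pointwise z = trans (sym (*-distribʳ-+ (g z) (𝟙 (z ∈? p)) (𝟙 (a ≟ᶠ z)))) (cong (_* g z) (𝟙-split z))

∣∣≡∑∈1 : (p : Subset n) → ∣ p ∣ ≡ ∑∈ p (λ _ → 1)
∣∣≡∑∈1 p = sym (trans (∑∈-const p 1) (*-identityʳ ∣ p ∣))

∣remove∣ : {x : Fin n} {p : Subset n} → x ∈ p → ∣ remove x p ∣ + 1 ≡ ∣ p ∣
∣remove∣ {x = x} {p} x∈p =
  trans (cong (_+ 1) (∣∣≡∑∈1 (remove x p))) (trans (∑∈-split-point x (𝟙-remove x∈p) (λ _ → 1)) (sym (∣∣≡∑∈1 p)))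

∣insert∣ : {x : Fin n} {p : Subset n} → x ∉ p → ∣ insert x p ∣ ≡ ∣ p ∣ + 1
∣insert∣ {x = x} {p} x∉p =
  trans (∣∣≡∑∈1 (insert x p)) (sym (trans (cong (_+ 1) (∣∣≡∑∈1 p))
    (∑∈-split-point x (𝟙-insert x∉p) (λ _ → 1))))

exchange : Fin n → Fin n → Subset n → Subset n
exchange a b p = insert b (remove a p)

module _ {a b : Fin n} {p : Subset n} (a∈p : a ∈ p) (b∉p : b ∉ p) where

  private
    b∉p-a : b ∉ remove a p
    b∉p-a b∈ = b∉p (proj₁ (∈⟦⟧⁻ (λ z → z ∈? p ×-dec ¬? (a ≟ᶠ z)) b∈))

  ∑∈-exchange : (g : Fin n → ℕ) → ∑∈ (exchange a b p) g + g a ≡ ∑∈ p g + g b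
  ∑∈-exchange g = begin
    ∑∈ (insert b (remove a p)) g + g a    ≡⟨ cong (_+ g a) (∑∈-split-point b (𝟙-insert b∉p-a) g) ⟨
    ∑∈ (remove a p) g + g b + g a         ≡⟨ +-assoc _ (g b) (g a) ⟩
    ∑∈ (remove a p) g + (g b + g a)       ≡⟨ cong (∑∈ (remove a p) g +_) (+-comm (g b) (g a)) ⟩
    ∑∈ (remove a p) g + (g a + g b)       ≡⟨ +-assoc _ (g a) (g b) ⟨
    ∑∈ (remove a p) g + g a + g b         ≡⟨ cong (_+ g b) (∑∈-split-point a (𝟙-remove a∈p) g) ⟩
    ∑∈ p g + g b                          ∎
    where open ≡-Reasoning

  ∣exchange∣ : ∣ exchange a b p ∣ ≡ ∣ p ∣
  ∣exchange∣ = +-cancelʳ-≡ 1 ∣ exchange a b p ∣ ∣ p ∣ (trans (cong (_+ 1) (∣∣≡∑∈1 (exchange a b p)))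
    (trans (∑∈-exchange (λ _ → 1)) (cong (_+ 1) (sym (∣∣≡∑∈1 p)))))

k-set-through : ∀ {k} (T : Subset n) {y : Fin n} → y ∉ T → ∣ T ∣ + k ≤ n → 1 ≤ k →
                Σ (KSubset n k) (λ B → y ∈ proj₁ B × Disjoint (proj₁ B) T)
k-set-through {n} {k} T {y} y∉T ∣T∣+k≤n 1≤k = (B , ∣B∣) , ∈⟦⟧⁺ B? (inj₁ refl) , B∩T≡∅
  where
  R = remove y (∁ T)
  S = shrinkTo (k ∸ 1) R
  B? = λ z → (y ≟ᶠ z) ⊎-dec (z ∈? S)
  B = insert y S

  S⊆∁T-y : ∀ {z} → z ∈ S → z ∈ ∁ T × ¬ y ≡ z
  S⊆∁T-y z∈S = ∈⟦⟧⁻ (λ z → z ∈? ∁ T ×-dec ¬? (y ≟ᶠ z)) (shrinkTo-⊆ (k ∸ 1) R z∈S)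

  k∸1≤∣R∣ : k ∸ 1 ≤ ∣ R ∣
  k∸1≤∣R∣ = +-cancelʳ-≤ 1 _ _ (begin
    k ∸ 1 + 1         ≡⟨ m∸n+n≡m 1≤k ⟩
    k                 ≡⟨ m+n∸m≡n ∣ T ∣ k ⟨
    ∣ T ∣ + k ∸ ∣ T ∣ ≤⟨ ∸-monoˡ-≤ ∣ T ∣ ∣T∣+k≤n ⟩
    n ∸ ∣ T ∣         ≡⟨ ∣∁p∣≡n∸∣p∣ T ⟨
    ∣ ∁ T ∣           ≡⟨ ∣remove∣ (x∉p⇒x∈∁p y∉T) ⟨
    ∣ R ∣ + 1         ∎)
    where open ≤-Reasoning

  ∣B∣ : ∣ B ∣ ≡ k
  ∣B∣ = begin
    ∣ insert y S ∣    ≡⟨ ∣insert∣ (λ y∈S → proj₂ (S⊆∁T-y y∈S) refl) ⟩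
    ∣ S ∣ + 1         ≡⟨ cong (_+ 1) (∣shrinkTo∣ (k ∸ 1) R k∸1≤∣R∣) ⟩
    k ∸ 1 + 1         ≡⟨ m∸n+n≡m 1≤k ⟩
    k                 ∎
    where open ≡-Reasoning

  B∩T≡∅ : Disjoint B T
  B∩T≡∅ z z∈B z∈T with ∈⟦⟧⁻ B? z∈B
  ... | inj₁ refl = y∉T z∈T
  ... | inj₂ z∈S = x∈∁p⇒x∉p (proj₁ (S⊆∁T-y z∈S)) z∈T

∣∣≤length : (p : Subset n) (xs : List (Fin n)) → (∀ {z} → z ∈ p → z ∈ₗ xs) → ∣ p ∣ ≤ length xs
∣∣≤length p [] p⊆xs = ≤-reflexive (trans (∣p∣≡∑𝟙∈ p) (sum-zero _ (λ z → 𝟙-no (z ∈? p) (λ z∈p → nowhere (p⊆xs z∈p)))))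
  where
  nowhere : ∀ {z} → z ∉ₗ []
  nowhere ()
∣∣≤length p (x ∷ xs) p⊆x∷xs with x ∈? p
... | yes x∈p = begin
  ∣ p ∣                ≡⟨ ∣remove∣ x∈p ⟨
  ∣ remove x p ∣ + 1   ≤⟨ +-monoˡ-≤ 1 (∣∣≤length (remove x p) xs rest) ⟩
  length xs + 1        ≡⟨ +-comm (length xs) 1 ⟩
  length (x ∷ xs)      ∎
  where
  open ≤-Reasoning
  rest : ∀ {z} → z ∈ remove x p → z ∈ₗ xs
  rest z∈ with ∈⟦⟧⁻ (λ z → z ∈? p ×-dec ¬? (x ≟ᶠ z)) z∈
  ... | z∈p , x≢z with p⊆x∷xs z∈p
  ...   | Any.here z≡x = contradiction (sym z≡x) x≢z
  ...   | Any.there z∈xs = z∈xs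
... | no x∉p = ≤-trans (∣∣≤length p xs rest) (n≤1+n _)
  where
  rest : ∀ {z} → z ∈ p → z ∈ₗ xs
  rest z∈p with p⊆x∷xs z∈p
  ... | Any.here refl = contradiction z∈p x∉p
  ... | Any.there z∈xs = z∈xs

lookupOr : {A : Set} → List A → A → ℕ → A
lookupOr [] d _ = d
lookupOr (x ∷ xs) d zero = x
lookupOr (x ∷ xs) d (suc p) = lookupOr xs d p

module _ {A : Set} where

  lookupOr-∈ : (xs : List A) (d : A) {p : ℕ} → p < length xs → lookupOr xs d p ∈ₗ xs
  lookupOr-∈ (x ∷ xs) d {zero} _ = Any.here refl
  lookupOr-∈ (x ∷ xs) d {suc p} (s≤s p<) = Any.there (lookupOr-∈ xs d p<)

  lookupOr-++ˡ : (xs ys : List A) (d : A) {p : ℕ} → p < length xs → lookupOr (xs ++ ys) d p ≡ lookupOr xs d p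
  lookupOr-++ˡ (x ∷ xs) ys d {zero} _ = refl
  lookupOr-++ˡ (x ∷ xs) ys d {suc p} (s≤s p<) = lookupOr-++ˡ xs ys d p<

  lookupOr-++ʳ : (xs ys : List A) (d : A) (p : ℕ) → lookupOr (xs ++ ys) d (length xs + p) ≡ lookupOr ys d p
  lookupOr-++ʳ [] ys d p = refl
  lookupOr-++ʳ (x ∷ xs) ys d p = lookupOr-++ʳ xs ys d p

  lookupOr-injective : {xs : List A} (d : A) → Unique xs → ∀ {p q} → p < length xs → q < length xs →
                       lookupOr xs d p ≡ lookupOr xs d q → p ≡ q
  lookupOr-injective {x ∷ xs} d _ {zero} {zero} _ _ _ = refl
  lookupOr-injective {x ∷ xs} d (x∉xs ∷ _) {zero} {suc q} _ (s≤s q<) eq = contradiction eq (All.lookup x∉xs (lookupOr-∈ xs d q<))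
  lookupOr-injective {x ∷ xs} d (x∉xs ∷ _) {suc p} {zero} (s≤s p<) _ eq = contradiction (sym eq) (All.lookup x∉xs (lookupOr-∈ xs d p<))
  lookupOr-injective {x ∷ xs} d (_ ∷ unique) {suc p} {suc q} (s≤s p<) (s≤s q<) eq = cong suc (lookupOr-injective d unique p< q< eq)

  length-filter-partition : {P : Pred A 0ℓ} (P? : Decidable P) (xs : List A) →
                            length (filter P? xs) + length (filter (¬? ∘ P?) xs) ≡ length xs
  length-filter-partition P? [] = refl
  length-filter-partition P? (x ∷ xs) with P? x
  ... | yes _ = cong suc (length-filter-partition P? xs)
  ... | no _ = trans (+-suc _ _) (cong suc (length-filter-partition P? xs))

-- Operations on colourings

repeat : ∀ {m} q → Subset m → Subset (q * m)
repeat zero _ = []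
repeat (suc q) p = p Vec.++ repeat q p

∣++∣ : ∀ {a b} (p : Subset a) (q : Subset b) → ∣ p Vec.++ q ∣ ≡ ∣ p ∣ + ∣ q ∣
∣++∣ [] q = refl
∣++∣ (inside ∷ p) q = cong suc (∣++∣ p q)
∣++∣ (outside ∷ p) q = ∣++∣ p q

∣repeat∣ : ∀ {m} q (p : Subset m) → ∣ repeat q p ∣ ≡ q * ∣ p ∣
∣repeat∣ zero p = refl
∣repeat∣ (suc q) p = trans (∣++∣ p (repeat q p)) (cong (∣ p ∣ +_) (∣repeat∣ q p))

Disjoint-++ : ∀ {a b} {p p′ : Subset a} {q q′ : Subset b} → Disjoint p p′ → Disjoint q q′ → Disjoint (p Vec.++ q) (p′ Vec.++ q′)
Disjoint-++ {p = []} {[]} _ q∩q′≡∅ = q∩q′≡∅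
Disjoint-++ {p = _ ∷ p} {_ ∷ p′} p∩p′≡∅ _ zero here here = p∩p′≡∅ zero here here
Disjoint-++ {p = _ ∷ p} {_ ∷ p′} p∩p′≡∅ q∩q′≡∅ (suc x) (there x∈) (there x∈′) =
  Disjoint-++ (λ z z∈ z∈′ → p∩p′≡∅ (suc z) (there z∈) (there z∈′)) q∩q′≡∅ x x∈ x∈′

Disjoint-repeat : ∀ {m} q {p p′ : Subset m} → Disjoint p p′ → Disjoint (repeat q p) (repeat q p′)
Disjoint-repeat zero _ ()
Disjoint-repeat (suc q) p∩p′≡∅ = Disjoint-++ p∩p′≡∅ (Disjoint-repeat q p∩p′≡∅)

dropCoordinates : ∀ {m} (S p : Subset m) → Subset ∣ ∁ S ∣
dropCoordinates [] [] = []
dropCoordinates (inside ∷ S) (_ ∷ p) = dropCoordinates S p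
dropCoordinates (outside ∷ S) (b ∷ p) = b ∷ dropCoordinates S p

∣dropCoordinates∣ : ∀ {m} (S p : Subset m) → ∣ dropCoordinates S p ∣ + ∑∈ S (λ x → 𝟙 (x ∈? p)) ≡ ∣ p ∣
∣dropCoordinates∣ [] [] = refl
∣dropCoordinates∣ (inside ∷ S) (inside ∷ p) = trans (+-suc _ _) (cong suc (∣dropCoordinates∣ S p))
∣dropCoordinates∣ (inside ∷ S) (outside ∷ p) = ∣dropCoordinates∣ S p
∣dropCoordinates∣ (outside ∷ S) (inside ∷ p) = cong suc (∣dropCoordinates∣ S p)
∣dropCoordinates∣ (outside ∷ S) (outside ∷ p) = ∣dropCoordinates∣ S p

Disjoint-dropCoordinates : ∀ {m} (S : Subset m) {p q : Subset m} → Disjoint p q → Disjoint (dropCoordinates S p) (dropCoordinates S q)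
Disjoint-dropCoordinates [] {[]} {[]} _ ()
Disjoint-dropCoordinates (inside ∷ S) {_ ∷ p} {_ ∷ q} p∩q≡∅ =
  Disjoint-dropCoordinates S (λ z z∈ z∈′ → p∩q≡∅ (suc z) (there z∈) (there z∈′))
Disjoint-dropCoordinates (outside ∷ S) {_ ∷ p} {_ ∷ q} p∩q≡∅ zero here here = p∩q≡∅ zero here here
Disjoint-dropCoordinates (outside ∷ S) {_ ∷ p} {_ ∷ q} p∩q≡∅ (suc x) (there x∈) (there x∈′) =
  Disjoint-dropCoordinates S (λ z z∈ z∈′ → p∩q≡∅ (suc z) (there z∈) (there z∈′)) x x∈ x∈′

module _ {V : Set} {E : V → V → Set} where

  Colourable-cast : ∀ {m m′ j} → m ≡ m′ → Colourable V E m j → Colourable V E m′ j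
  Colourable-cast refl col = col

  shrink-colouring : ∀ {m j j′} → j′ ≤ j → Colourable V E m j → Colourable V E m j′
  shrink-colouring {j′ = j′} j′≤j (c , proper) = c′ , λ u v uv x x∈ x∈′ → proper u v uv x (shrinkTo-⊆ j′ _ x∈) (shrinkTo-⊆ j′ _ x∈′)
    where
    c′ : V → KSubset _ j′
    c′ v = shrinkTo j′ (proj₁ (c v)) , ∣shrinkTo∣ j′ (proj₁ (c v)) (subst (j′ ≤_) (sym (proj₂ (c v))) j′≤j)

  blow-up : ∀ {m j} q → Colourable V E m j → Colourable V E (q * m) (q * j)
  blow-up q (c , proper) = c′ , λ u v uv → Disjoint-repeat q (proper u v uv)
    where
    c′ : V → KSubset _ _
    c′ v = repeat q (proj₁ (c v)) , trans (∣repeat∣ q (proj₁ (c v))) (cong (q *_) (proj₂ (c v)))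

  delete-colours : ∀ {m j i} (S : Subset m) (c : V → KSubset m j) → (∀ u v → E u v → Disjoint (proj₁ (c u)) (proj₁ (c v))) →
                   (∀ v → ∑∈ S (λ x → 𝟙 (x ∈? proj₁ (c v))) ≡ i) → Colourable V E (m ∸ ∣ S ∣) (j ∸ i)
  delete-colours {j = j} {i} S c proper meets =
    Colourable-cast (∣∁p∣≡n∸∣p∣ S) (c′ , λ u v uv → Disjoint-dropCoordinates S (proper u v uv))
    where
    c′ : V → KSubset _ (j ∸ i)
    c′ v = dropCoordinates S p , (begin
      ∣ dropCoordinates S p ∣                                  ≡⟨ m+n∸n≡m _ i ⟨
      ∣ dropCoordinates S p ∣ + i ∸ i                          ≡⟨ cong (λ t → ∣ dropCoordinates S p ∣ + t ∸ i) (meets v) ⟨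
      ∣ dropCoordinates S p ∣ + ∑∈ S (λ x → 𝟙 (x ∈? p)) ∸ i    ≡⟨ cong (_∸ i) (∣dropCoordinates∣ S p) ⟩
      ∣ p ∣ ∸ i                                                ≡⟨ cong (_∸ i) (proj₂ (c v)) ⟩
      j ∸ i                                                    ∎)
      where
      open ≡-Reasoning
      p = proj₁ (c v)

-- Katona's circle

rising-edge : (f : ℕ → ℕ) → (∀ s → f s ≤ 1) → ∀ z e → f z ≡ 0 → f (z + e) ≡ 1 → ∃[ w ] f w ≡ 0 × f (suc w) ≡ 1
rising-edge f f≤1 z zero fz≡0 fz≡1 = contradiction (trans (sym fz≡0) (trans (cong f (sym (+-identityʳ z))) fz≡1)) λ ()
rising-edge f f≤1 z (suc e) fz≡0 fz+e+1≡1 with f (z + e) ≟ 0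
... | yes fz+e≡0 = z + e , fz+e≡0 , trans (cong f (sym (+-suc z e))) fz+e+1≡1
... | no fz+e≢0 = rising-edge f f≤1 z e fz≡0 (≤-antisym (f≤1 (z + e)) (n≢0⇒n>0 fz+e≢0))

module Katona {n k : ℕ} (2k<n : k + k < n) (P : ℕ → ℕ) (P≤1 : ∀ s → P s ≤ 1)
  (P-periodic : ∀ s → P (s + n) ≡ P s) (P-far : ∀ s d → k ≤ d → d + k ≤ n → P s + P (s + d) ≤ 1) where

  count : ℕ
  count = ∑ℕ[ s < n ] P s

  private
    M : ℕ
    M = n ∸ suc (k + k)

    D : ℕ
    D = k + suc M

    n≡D+k : n ≡ D + k
    n≡D+k = trans (sym (m+[n∸m]≡n 2k<n)) (rearrange k M)
      where
      rearrange : ∀ k M → suc (k + k) + M ≡ k + suc M + k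
      rearrange = solve-∀

    partner : ∀ a d → a + d + D ≡ a + (D + d)
    partner a d = trans (+-assoc a d D) (cong (a +_) (+-comm d D))

    pair≤1 : ∀ a d → P (a + d) + P (a + (D + d)) ≤ 1
    pair≤1 a d = subst (λ x → P (a + d) + P x ≤ 1) (partner a d) (P-far (a + d) D (m≤m+n k (suc M)) (≤-reflexive (sym n≡D+k)))

    middle≡0 : ∀ a → P a ≡ 1 → ∀ e → e < suc M → P (a + (k + e)) ≡ 0
    middle≡0 a Pa≡1 e e≤M = n≤0⇒n≡0 (+-cancelˡ-≤ 1 _ _
      (subst (λ x → x + P (a + (k + e)) ≤ 1) Pa≡1 (P-far a (k + e) (m≤m+n k e) k+e+k≤n)))
      where
      k+e+k≤n : k + e + k ≤ n
      k+e+k≤n = ≤-trans (+-monoˡ-≤ k (+-monoʳ-≤ k (<⇒≤ e≤M))) (≤-reflexive (sym n≡D+k))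

    pairSum : ℕ → ℕ
    pairSum a = ∑ℕ[ d < k ] (P (a + d) + P (a + (D + d)))

    -- Seen from a point a with P a ≡ 1, the positions at distance k, …, n − k vanish and the
    -- remaining ones pair up at distance n − k.
    count≡pairSum : ∀ a → P a ≡ 1 → count ≡ pairSum a
    count≡pairSum a Pa≡1 = begin
      ∑ℕ[ s < n ] P s                                         ≡⟨ rangeSum-periodic n P P-periodic a ⟨
      ∑ℕ[ d < n ] P (a + d)                                   ≡⟨ cong (λ m → rangeSum m (λ d → P (a + d))) n≡D+k ⟩
      ∑ℕ[ d < D + k ] P (a + d)                               ≡⟨ rangeSum-split D k (λ d → P (a + d)) ⟩
      ∑ℕ[ d < D ] P (a + d) + ∑ℕ[ d < k ] P (a + (D + d))     ≡⟨ cong (_+ ∑ℕ[ d < k ] P (a + (D + d))) (rangeSum-split k (suc M) (λ d → P (a + d))) ⟩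
      ∑ℕ[ d < k ] P (a + d) + ∑ℕ[ e < suc M ] P (a + (k + e)) + ∑ℕ[ d < k ] P (a + (D + d))
        ≡⟨ cong (λ x → ∑ℕ[ d < k ] P (a + d) + x + ∑ℕ[ d < k ] P (a + (D + d))) middle-sum≡0 ⟩
      ∑ℕ[ d < k ] P (a + d) + 0 + ∑ℕ[ d < k ] P (a + (D + d)) ≡⟨ cong (_+ ∑ℕ[ d < k ] P (a + (D + d))) (+-identityʳ _) ⟩
      ∑ℕ[ d < k ] P (a + d) + ∑ℕ[ d < k ] P (a + (D + d))     ≡⟨ ∑-distrib-+ {k} (λ i → P (a + toℕ i)) (λ i → P (a + (D + toℕ i))) ⟨
      pairSum a                                               ∎
      where
      open ≡-Reasoning
      middle-sum≡0 : ∑ℕ[ e < suc M ] P (a + (k + e)) ≡ 0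
      middle-sum≡0 = sum-zero (λ i → P (a + (k + toℕ i))) (λ i → middle≡0 a Pa≡1 (toℕ i) (toℕ<n i))

  count≤k : count ≤ k
  count≤k with count ≟ 0
  ... | yes count≡0 = ≤-trans (≤-reflexive count≡0) z≤n
  ... | no count≢0 with positive-term {n} (λ i → P (toℕ i)) (n≢0⇒n>0 count≢0)
  ...   | i , 0<P = begin
    count                  ≡⟨ count≡pairSum (toℕ i) (≤-antisym (P≤1 (toℕ i)) 0<P) ⟩
    pairSum (toℕ i)        ≤⟨ sum-mono-≤ {k} (λ d → pair≤1 (toℕ i) (toℕ d)) ⟩
    ∑[ d < k ] 1           ≡⟨ trans (sum-const k 1) (*-identityʳ k) ⟩
    k                      ∎
    where open ≤-Reasoning

  private
    count<n : count < n
    count<n = ≤-<-trans count≤k (≤-<-trans (m≤m+n k k) 2k<n)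

    rising-edge-exists : 1 ≤ count → ∃[ w ] P w ≡ 0 × P (suc w) ≡ 1
    rising-edge-exists 1≤count =
      let (z , Pz≡0) = zero-term {n} (λ i → P (toℕ i)) (λ i → P≤1 (toℕ i)) count<n
          (o , 0<Po) = positive-term {n} (λ i → P (toℕ i)) 1≤count
          z≤o+n = ≤-trans (<⇒≤ (toℕ<n z)) (m≤n+m n (toℕ o))
      in rising-edge P P≤1 (toℕ z) (toℕ o + n ∸ toℕ z) Pz≡0
           (trans (cong P (m+[n∸m]≡n z≤o+n)) (trans (P-periodic (toℕ o)) (≤-antisym (P≤1 (toℕ o)) 0<Po)))

    saturated : ∀ a → P a ≡ 1 → k ≤ count → ∀ {d} → d < k → P (a + d) + P (a + (D + d)) ≡ 1
    saturated a Pa≡1 k≤count d<k = subst (λ e → P (a + e) + P (a + (D + e)) ≡ 1) (toℕ-fromℕ< d<k)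
      (all-one {k} (λ i → P (a + toℕ i) + P (a + (D + toℕ i))) (λ i → pair≤1 a (toℕ i))
               (subst (k ≤_) (count≡pairSum a Pa≡1) k≤count) (fromℕ< d<k))

    from-pair : ∀ {x y} → x + y ≡ 1 → y ≡ 0 → x ≡ 1
    from-pair {x} x+y≡1 y≡0 = trans (sym (+-identityʳ x)) (trans (cong (x +_) (sym y≡0)) x+y≡1)

    -- Going down from the end of the run, the partner of each position is either w itself or
    -- killed by the next position of the run.
    run-after-edge : ∀ {w} → P w ≡ 0 → P (suc w) ≡ 1 → k ≤ count → ∀ u t → t + suc u ≡ k → P (suc w + t) ≡ 1
    run-after-edge {w} Pw≡0 Pw+1≡1 k≤count zero t t+1≡k =
      from-pair (saturated (suc w) Pw+1≡1 k≤count t<k) (trans (cong P wrap) (trans (P-periodic w) Pw≡0))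
      where
      t<k : t < k
      t<k = ≤-trans (≤-reflexive (+-comm 1 t)) (≤-reflexive t+1≡k)
      wrap : suc w + (D + t) ≡ w + n
      wrap = trans (sym (+-suc w (D + t)))
        (cong (w +_) (trans (sym (+-suc D t)) (trans (cong (D +_) (trans (+-comm 1 t) t+1≡k)) (sym n≡D+k))))
    run-after-edge {w} Pw≡0 Pw+1≡1 k≤count (suc u) t t+u+2≡k =
      from-pair (saturated (suc w) Pw+1≡1 k≤count t<k) partner≡0
      where
      t<k : t < k
      t<k = ≤-trans (s≤s (m≤m+n t (suc u))) (≤-reflexive (trans (sym (+-suc t (suc u))) t+u+2≡k))
      next : P (suc w + suc t) ≡ 1
      next = run-after-edge Pw≡0 Pw+1≡1 k≤count u (suc t) (trans (sym (+-suc t (suc u))) t+u+2≡k)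
      shift : ∀ w t k M → suc w + suc t + (k + M) ≡ suc w + (k + suc M + t)
      shift = solve-∀
      partner≡0 : P (suc w + (D + t)) ≡ 0
      partner≡0 = n≤0⇒n≡0 (+-cancelˡ-≤ 1 _ _ (subst₂ (λ x y → x + P y ≤ 1) next (shift w t k M)
        (P-far (suc w + suc t) (k + M) (m≤m+n k M) (≤-trans (+-monoˡ-≤ k (+-monoʳ-≤ k (n≤1+n M))) (≤-reflexive (sym n≡D+k))))))

  full⇒run : k ≤ count → ∃[ b ] (∀ t → t < k → P (b + t) ≡ 1)
  full⇒run k≤count with k ≟ 0
  ... | yes k≡0 = 0 , λ t t<k → contradiction (subst (t <_) k≡0 t<k) λ ()
  ... | no k≢0 = let (w , Pw≡0 , Pw+1≡1) = rising-edge-exists (≤-trans (n≢0⇒n>0 k≢0) k≤count) in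
    suc w , λ t t<k → run-after-edge Pw≡0 Pw+1≡1 k≤count (k ∸ suc t) t (trans (+-suc t _) (m+[n∸m]≡n t<k))

-- Cyclic orders and their windows

record CyclicOrder (n : ℕ) ⦃ _ : NonZero n ⦄ : Set where
  field
    at : ℕ → Fin n
    at-cong-% : ∀ {s s′} → s % n ≡ s′ % n → at s ≡ at s′
    at-injective : ∀ s {t u} → t < n → u < n → at (s + t) ≡ at (s + u) → t ≡ u

module _ {n : ℕ} ⦃ _ : NonZero n ⦄ where

  toℕ-mod : ∀ s → toℕ (s mod n) ≡ s % n
  toℕ-mod s = toℕ-fromℕ< (m%n<n s n)

  +-cong-% : ∀ s s′ t → s % n ≡ s′ % n → (s + t) % n ≡ (s′ + t) % n
  +-cong-% s s′ t eq = trans (%-distribˡ-+ s t n) (trans (cong (λ r → (r + t % n) % n) eq) (sym (%-distribˡ-+ s′ t n)))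

  identityOrder : CyclicOrder n
  identityOrder = record
    { at = _mod n
    ; at-cong-% = λ {s} {s′} eq → toℕ-injective (trans (toℕ-mod s) (trans eq (sym (toℕ-mod s′))))
    ; at-injective = λ s {t} {u} t<n u<n eq →
        %-injective-on-arc s t<n u<n (trans (sym (toℕ-mod (s + t))) (trans (cong toℕ eq) (toℕ-mod (s + u))))
    }

  fromPositions : (element : ℕ → Fin n) → (∀ {p q} → p < n → q < n → element p ≡ element q → p ≡ q) → CyclicOrder n
  fromPositions element element-injective = record
    { at = λ s → element (s % n)
    ; at-cong-% = cong element
    ; at-injective = λ s t<n u<n eq → %-injective-on-arc s t<n u<n (element-injective (m%n<n _ n) (m%n<n _ n) eq)
    }

  module Windows (o : CyclicOrder n) {k : ℕ} (k≤n : k ≤ n) where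

    open CyclicOrder o public

    private
      f : ℕ → Fin k → Fin n
      f s t = at (s + toℕ t)

      f-injective : ∀ s → Injective _≡_ _≡_ (f s)
      f-injective s eq = toℕ-injective (at-injective s (<-≤-trans (toℕ<n _) k≤n) (<-≤-trans (toℕ<n _) k≤n) eq)

    window : ℕ → KVertex n k
    window s = image (f s) , ∣image∣ (f s) (f-injective s)

    ∈-window⁻ : ∀ s {x} → x ∈ proj₁ (window s) → ∃[ t ] t < k × at (s + t) ≡ x
    ∈-window⁻ s x∈ = let (t , eq) = ∈-image⁻ (f s) x∈ in toℕ t , toℕ<n t , eq

    window-cong-% : ∀ s s′ → s % n ≡ s′ % n → window s ≡ window s′
    window-cong-% s s′ eq = vertex-≡ (image-cong (λ t → at-cong-% (+-cong-% s s′ (toℕ t) eq)))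

    window-far : ∀ s {d} → k ≤ d → d + k ≤ n → Disjoint (proj₁ (window s)) (proj₁ (window (s + d)))
    window-far s {d} k≤d d+k≤n x x∈ x∈′ with ∈-window⁻ s x∈ | ∈-window⁻ (s + d) x∈′
    ... | t , t<k , eq | u , u<k , eq′ = <⇒≢ (<-≤-trans t<k (≤-trans k≤d (m≤m+n d u))) t≡d+u
      where
      t≡d+u : t ≡ d + u
      t≡d+u = at-injective s (<-≤-trans t<k k≤n) (<-≤-trans (+-monoʳ-< d u<k) d+k≤n)
                (trans eq (trans (sym eq′) (cong at (+-assoc s d u))))

  _⊕_ : Fin n → ℕ → Fin n
  y ⊕ u = (toℕ y + u) mod n

  ⊕-injective : ∀ y {u v} → u < n → v < n → y ⊕ u ≡ y ⊕ v → u ≡ v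
  ⊕-injective y = CyclicOrder.at-injective identityOrder (toℕ y)

  ⊕-distinct : ∀ y {u v} → u < v → v < u + n → y ⊕ u ≢ y ⊕ v
  ⊕-distinct y {u} {v} u<v v<u+n eq = %-distinct-on-arc (toℕ y + u) (m<n⇒0<n∸m u<v) v∸u<n (begin
    (toℕ y + u + 0) % n       ≡⟨ cong (_% n) (+-identityʳ _) ⟩
    (toℕ y + u) % n           ≡⟨ toℕ-mod _ ⟨
    toℕ (y ⊕ u)               ≡⟨ cong toℕ eq ⟩
    toℕ (y ⊕ v)               ≡⟨ toℕ-mod _ ⟩
    (toℕ y + v) % n           ≡⟨ cong (_% n) shift ⟩
    (toℕ y + u + (v ∸ u)) % n ∎)
    where
    open ≡-Reasoning
    v∸u<n : v ∸ u < n
    v∸u<n = +-cancelˡ-< u _ _ (subst (_< u + n) (sym (m+[n∸m]≡n (<⇒≤ u<v))) v<u+n)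
    shift : toℕ y + v ≡ toℕ y + u + (v ∸ u)
    shift = trans (cong (toℕ y +_) (sym (m+[n∸m]≡n (<⇒≤ u<v)))) (sym (+-assoc (toℕ y) u (v ∸ u)))

  ⊕-zero : ∀ y → y ⊕ 0 ≡ y
  ⊕-zero y = toℕ-injective (trans (toℕ-mod _) (trans (cong (_% n) (+-identityʳ _)) (m<n⇒m%n≡m (toℕ<n y))))

  ⊕-surjective : ∀ y z → ∃[ u ] u < n × y ⊕ u ≡ z
  ⊕-surjective y z = u , m%n<n _ n , toℕ-injective (begin
    toℕ (y ⊕ u)                             ≡⟨ toℕ-mod _ ⟩
    (toℕ y + u) % n                         ≡⟨ %-distribˡ-+ (toℕ y) u n ⟩
    (toℕ y % n + u % n) % n                 ≡⟨ cong (λ r → (toℕ y % n + r) % n) (m%n%n≡m%n _ n) ⟩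
    (toℕ y % n + (toℕ z + (n ∸ toℕ y)) % n) % n ≡⟨ %-distribˡ-+ (toℕ y) (toℕ z + (n ∸ toℕ y)) n ⟨
    (toℕ y + (toℕ z + (n ∸ toℕ y))) % n     ≡⟨ cong (_% n) (rearrange (toℕ y) (toℕ z) (n ∸ toℕ y)) ⟩
    (toℕ z + (toℕ y + (n ∸ toℕ y))) % n     ≡⟨ cong (λ m → (toℕ z + m) % n) (m+[n∸m]≡n (<⇒≤ (toℕ<n y))) ⟩
    (toℕ z + n) % n                         ≡⟨ [m+n]%n≡m%n (toℕ z) n ⟩
    toℕ z % n                               ≡⟨ m<n⇒m%n≡m (toℕ<n z) ⟩
    toℕ z                                   ∎)
    where
    open ≡-Reasoning
    u = (toℕ z + (n ∸ toℕ y)) % n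
    rearrange : ∀ a b c → a + (b + c) ≡ b + (a + c)
    rearrange = solve-∀

  -- Starting from y, list the k elements following y in the identity order with those of A
  -- first, then the remaining elements with those of A last, so that, when ∣ A ∣ ≡ k and
  -- y ∈ A, the set A becomes the window wrapping around y.
  module AdaptedOrder {k : ℕ} (k<n : k < n) (y : Fin n) (A : Subset n) where

    private
      R : ℕ
      R = n ∸ suc k

      n≡1+k+R : suc (k + R) ≡ n
      n≡1+k+R = m+[n∸m]≡n k<n

      X Y : List (Fin n)
      X = applyUpTo (λ u → y ⊕ suc u) k
      Y = applyUpTo (λ u → y ⊕ suc (k + u)) R

      in? : Decidable (_∈ A)
      in? z = z ∈? A

      XA XN YN YA Xs Ys : List (Fin n)
      XA = filter in? X
      XN = filter (¬? ∘ in?) X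
      YN = filter (¬? ∘ in?) Y
      YA = filter in? Y
      Xs = XA ++ XN
      Ys = YN ++ YA

      L : List (Fin n)
      L = y ∷ Xs ++ Ys

      k+u<n : ∀ {u} → u < R → suc (k + u) < n
      k+u<n u<R = ≤-trans (s≤s (+-monoʳ-< k u<R)) (≤-reflexive n≡1+k+R)

      ∈X⁻ : ∀ {z} → z ∈ₗ X → ∃[ u ] u < k × z ≡ y ⊕ suc u
      ∈X⁻ = ∈-applyUpTo⁻ (λ u → y ⊕ suc u)

      ∈Y⁻ : ∀ {z} → z ∈ₗ Y → ∃[ u ] u < R × z ≡ y ⊕ suc (k + u)
      ∈Y⁻ = ∈-applyUpTo⁻ (λ u → y ⊕ suc (k + u))

      ∈Xs⁻ : ∀ {z} → z ∈ₗ Xs → z ∈ₗ X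
      ∈Xs⁻ z∈ with ∈-++⁻ XA z∈
      ... | inj₁ z∈XA = proj₁ (∈-filter⁻ in? z∈XA)
      ... | inj₂ z∈XN = proj₁ (∈-filter⁻ (¬? ∘ in?) z∈XN)

      ∈Ys⁻ : ∀ {z} → z ∈ₗ Ys → z ∈ₗ Y
      ∈Ys⁻ z∈ with ∈-++⁻ YN z∈
      ... | inj₁ z∈YN = proj₁ (∈-filter⁻ (¬? ∘ in?) z∈YN)
      ... | inj₂ z∈YA = proj₁ (∈-filter⁻ in? z∈YA)

      1+u<n : ∀ {u} → u < k → suc u < n
      1+u<n u<k = ≤-trans (s≤s u<k) k<n

      unique-X : Unique X
      unique-X = Unique.applyUpTo⁺₁ _ k (λ i<j j<k eq →
        <⇒≢ i<j (suc-injective (⊕-injective y (1+u<n (<-trans i<j j<k)) (1+u<n j<k) eq)))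

      unique-Y : Unique Y
      unique-Y = Unique.applyUpTo⁺₁ _ R (λ i<j j<R eq →
        <⇒≢ i<j (+-cancelˡ-≡ k _ _ (suc-injective (⊕-injective y (k+u<n (<-trans i<j j<R)) (k+u<n j<R) eq))))

      X∩Y≡∅ : ∀ {z} → z ∈ₗ X → z ∈ₗ Y → ⊥
      X∩Y≡∅ z∈X z∈Y with ∈X⁻ z∈X | ∈Y⁻ z∈Y
      ... | u , u<k , refl | v , v<R , eq =
        <⇒≱ u<k (≤-trans (m≤m+n k v) (≤-reflexive (sym (suc-injective (⊕-injective y (1+u<n u<k) (k+u<n v<R) eq)))))

      y∉X : y ∉ₗ X
      y∉X y∈X = let (u , u<k , eq) = ∈X⁻ y∈X in
        contradiction (⊕-injective y (≤-trans (s≤s z≤n) k<n) (1+u<n u<k) (trans (⊕-zero y) eq)) λ ()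

      y∉Y : y ∉ₗ Y
      y∉Y y∈Y = let (u , u<R , eq) = ∈Y⁻ y∈Y in
        contradiction (⊕-injective y (≤-trans (s≤s z≤n) k<n) (k+u<n u<R) (trans (⊕-zero y) eq)) λ ()

      unique-partition : ∀ {xs} → Unique xs → Unique (filter in? xs ++ filter (¬? ∘ in?) xs)
      unique-partition {xs} u = Unique.++⁺ (Unique.filter⁺ in? u) (Unique.filter⁺ (¬? ∘ in?) u)
        λ (z∈A , z∉A) → proj₂ (∈-filter⁻ (¬? ∘ in?) {xs = xs} z∉A) (proj₂ (∈-filter⁻ in? {xs = xs} z∈A))

      unique-L : Unique L
      unique-L = All.tabulate y∉ ∷ Unique.++⁺ (unique-partition unique-X) unique-Ys
        (λ (z∈Xs , z∈Ys) → X∩Y≡∅ (∈Xs⁻ z∈Xs) (∈Ys⁻ z∈Ys))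
        where
        unique-Ys : Unique Ys
        unique-Ys = Unique.++⁺ (Unique.filter⁺ (¬? ∘ in?) unique-Y) (Unique.filter⁺ in? unique-Y)
          λ (z∉A , z∈A) → proj₂ (∈-filter⁻ (¬? ∘ in?) {xs = Y} z∉A) (proj₂ (∈-filter⁻ in? {xs = Y} z∈A))
        y∉ : ∀ {z} → z ∈ₗ Xs ++ Ys → y ≢ z
        y∉ z∈ refl with ∈-++⁻ Xs z∈
        ... | inj₁ y∈Xs = y∉X (∈Xs⁻ y∈Xs)
        ... | inj₂ y∈Ys = y∉Y (∈Ys⁻ y∈Ys)

      length-Xs : length Xs ≡ k
      length-Xs = trans (length-++ XA) (trans (length-filter-partition in? X) (length-applyUpTo _ k))

      length-Ys : length Ys ≡ R
      length-Ys = trans (length-++ YN) (trans (+-comm (length YN) (length YA)) (trans (length-filter-partition in? Y) (length-applyUpTo _ R)))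

      length-L : length L ≡ n
      length-L = trans (cong suc (trans (length-++ Xs) (cong₂ _+_ length-Xs length-Ys))) n≡1+k+R

    order : CyclicOrder n
    order = fromPositions (lookupOr L y) λ p<n q<n →
      lookupOr-injective y unique-L (subst (_ <_) (sym length-L) p<n) (subst (_ <_) (sym length-L) q<n)

    open Windows order (<⇒≤ k<n) using (window; at; at-cong-%; at-injective; ∈-window⁻)

    private
      at≡L : ∀ {p} → p < n → at p ≡ lookupOr L y p
      at≡L p<n = cong (lookupOr L y) (m<n⇒m%n≡m p<n)

      L-Xs : ∀ {e} → e < k → lookupOr L y (suc e) ≡ lookupOr Xs y e
      L-Xs e<k = lookupOr-++ˡ Xs Ys y (subst (_ <_) (sym length-Xs) e<k)

      L-Ys : ∀ q → lookupOr L y (suc (k + q)) ≡ lookupOr Ys y q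
      L-Ys q = subst (λ m → lookupOr (Xs ++ Ys) y (m + q) ≡ lookupOr Ys y q) length-Xs (lookupOr-++ʳ Xs Ys y q)

      at-wrap : ∀ e → at (n + e) ≡ at e
      at-wrap e = at-cong-% (trans (cong (_% n) (+-comm n e)) ([m+n]%n≡m%n e n))

      at-0 : at 0 ≡ y
      at-0 = at≡L (≤-trans (s≤s z≤n) k<n)

      at-n : at n ≡ y
      at-n = trans (cong at (sym (+-identityʳ n))) (trans (at-wrap 0) at-0)

    at-early : ∀ {t} → t < k → ∃[ u ] u < k × at (suc t) ≡ y ⊕ suc u
    at-early {t} t<k = ∈X⁻ (∈Xs⁻ (subst (_∈ₗ Xs) (sym (trans (at≡L (1+u<n t<k)) (L-Xs t<k)))
                                   (lookupOr-∈ Xs y (subst (_ <_) (sym length-Xs) t<k))))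

    at-late : ∀ {p} → k < p → p < n → ∃[ u ] k < u × u < n × at p ≡ y ⊕ u
    at-late {p} k<p p<n = let (v , v<R , eq) = ∈Y⁻ (∈Ys⁻ (lookupOr-∈ Ys y q<)) in
      suc (k + v) , s≤s (m≤m+n k v) , k+u<n v<R , trans at-p eq
      where
      q = p ∸ suc k
      p≡ : suc (k + q) ≡ p
      p≡ = m+[n∸m]≡n k<p
      q< : q < length Ys
      q< = subst (q <_) (sym length-Ys) (+-cancelˡ-< (suc k) q R (subst₂ _<_ (sym p≡) (sym n≡1+k+R) p<n))
      at-p : at p ≡ lookupOr Ys y q
      at-p = trans (at≡L p<n) (trans (cong (lookupOr L y) (sym p≡)) (L-Ys q))

    private
      ∣YN∣ ∣YA∣ ∣XA∣ s₀ : ℕ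
      ∣YN∣ = length YN
      ∣YA∣ = length YA
      ∣XA∣ = length XA
      s₀ = suc (k + ∣YN∣)

      s₀+∣YA∣≡n : s₀ + ∣YA∣ ≡ n
      s₀+∣YA∣≡n = trans (cong suc (+-assoc k ∣YN∣ ∣YA∣))
        (trans (cong (λ m → suc (k + m)) (trans (sym (length-++ YN)) length-Ys)) n≡1+k+R)

    module _ (∣A∣≡k : ∣ A ∣ ≡ k) (y∈A : y ∈ A) where

      private
        A⊆ : ∀ {z} → z ∈ A → z ∈ₗ y ∷ XA ++ YA
        A⊆ {z} z∈A with ⊕-surjective y z
        ... | zero , _ , eq = Any.here (trans (sym eq) (⊕-zero y))
        ... | suc u , u<n , refl with u <? k
        ...   | yes u<k = Any.there (∈-++⁺ˡ (∈-filter⁺ in? (∈-applyUpTo⁺ (λ u → y ⊕ suc u) u<k) z∈A))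
        ...   | no u≮k = Any.there (∈-++⁺ʳ XA (∈-filter⁺ in? z∈Y z∈A))
          where
          k≤u = ≮⇒≥ u≮k
          v<R : u ∸ k < R
          v<R = +-cancelˡ-< (suc k) _ _ (subst₂ _<_ (cong suc (sym (m+[n∸m]≡n k≤u))) (sym n≡1+k+R) u<n)
          z∈Y : y ⊕ suc u ∈ₗ Y
          z∈Y = subst (λ w → y ⊕ suc w ∈ₗ Y) (m+[n∸m]≡n k≤u) (∈-applyUpTo⁺ (λ v → y ⊕ suc (k + v)) v<R)

        k≤1+∣XA∣+∣YA∣ : k ≤ suc (∣XA∣ + ∣YA∣)
        k≤1+∣XA∣+∣YA∣ = subst₂ _≤_ (∣A∣≡k) (cong suc (length-++ XA)) (∣∣≤length (A) (y ∷ XA ++ YA) A⊆)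

        at-s₀+t∈A : ∀ {t} → t < k → at (s₀ + t) ∈ A
        at-s₀+t∈A {t} t<k with <-cmp t ∣YA∣
        ... | tri< t<∣YA∣ _ _ = subst (_∈ A) (sym at≡YA) (proj₂ (∈-filter⁻ in? {xs = Y} (lookupOr-∈ YA y t<∣YA∣)))
          where
          at≡YA : at (s₀ + t) ≡ lookupOr YA y t
          at≡YA = begin
            at (s₀ + t)                      ≡⟨ at≡L (subst (s₀ + t <_) s₀+∣YA∣≡n (+-monoʳ-< s₀ t<∣YA∣)) ⟩
            lookupOr L y (suc (k + ∣YN∣) + t)   ≡⟨ cong (λ m → lookupOr L y (suc m)) (+-assoc k ∣YN∣ t) ⟩
            lookupOr L y (suc (k + (∣YN∣ + t))) ≡⟨ L-Ys (∣YN∣ + t) ⟩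
            lookupOr Ys y (∣YN∣ + t)            ≡⟨ lookupOr-++ʳ YN YA y t ⟩
            lookupOr YA y t                  ∎
            where open ≡-Reasoning
        ... | tri≈ _ refl _ = subst (_∈ A) (sym (trans (cong at s₀+∣YA∣≡n) at-n)) y∈A
        ... | tri> _ _ ∣YA∣<t = subst (_∈ A) (sym at≡XA) (proj₂ (∈-filter⁻ in? {xs = X} (lookupOr-∈ XA y e<∣XA∣)))
          where
          e = t ∸ suc ∣YA∣
          t≡ : suc ∣YA∣ + e ≡ t
          t≡ = m+[n∸m]≡n ∣YA∣<t
          e<∣XA∣ : e < ∣XA∣
          e<∣XA∣ = +-cancelˡ-≤ ∣YA∣ (suc e) ∣XA∣ (subst₂ _≤_ (sym (+-suc ∣YA∣ e)) (+-comm ∣XA∣ ∣YA∣)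
                  (s≤s⁻¹ (subst (λ m → suc m ≤ suc (∣XA∣ + ∣YA∣)) (sym t≡) (≤-trans t<k k≤1+∣XA∣+∣YA∣))))
          e<k : e < k
          e<k = ≤-<-trans (m≤n+m e (suc ∣YA∣)) (subst (_< k) (sym t≡) t<k)
          at≡XA : at (s₀ + t) ≡ lookupOr XA y e
          at≡XA = begin
            at (s₀ + t)                 ≡⟨ cong (λ m → at (s₀ + m)) (sym t≡) ⟩
            at (s₀ + (suc ∣YA∣ + e))       ≡⟨ cong at (trans (rearrange s₀ ∣YA∣ e) (cong (_+ suc e) s₀+∣YA∣≡n)) ⟩
            at (n + suc e)              ≡⟨ at-wrap (suc e) ⟩
            at (suc e)                  ≡⟨ at≡L (1+u<n e<k) ⟩
            lookupOr L y (suc e)        ≡⟨ L-Xs e<k ⟩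
            lookupOr Xs y e             ≡⟨ lookupOr-++ˡ XA XN y e<∣XA∣ ⟩
            lookupOr XA y e             ∎
            where
            open ≡-Reasoning
            rearrange : ∀ s i e → s + (suc i + e) ≡ s + i + suc e
            rearrange = solve-∀

        window-s₀ : window s₀ ≡ (A , ∣A∣≡k)
        window-s₀ = vertex-≡ (⊆∧∣∣≤⇒≡ window⊆A (≤-reflexive (trans (∣A∣≡k) (sym (proj₂ (window s₀))))))
          where
          window⊆A : proj₁ (window s₀) ⊆ A
          window⊆A x∈ = let (t , t<k , eq) = ∈-window⁻ s₀ x∈ in subst (_∈ A) eq (at-s₀+t∈A t<k)

        ∣YA∣<k : ∣YA∣ < k
        ∣YA∣<k = let (t , t<k , eq) = ∈-window⁻ s₀ (subst (λ v → y ∈ proj₁ v) (sym window-s₀) y∈A) in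
          subst (_< k) (at-injective s₀ (<-≤-trans t<k (<⇒≤ k<n)) ∣YA∣<n (trans eq (sym at-s₀+∣YA∣))) t<k
          where
          ∣YA∣<n : ∣YA∣ < n
          ∣YA∣<n = subst (∣YA∣ <_) s₀+∣YA∣≡n (s≤s (m≤n+m ∣YA∣ (k + ∣YN∣)))
          at-s₀+∣YA∣ : at (s₀ + ∣YA∣) ≡ y
          at-s₀+∣YA∣ = trans (cong at s₀+∣YA∣≡n) at-n

      A-window : ∃[ t₀ ] t₀ < k × window (suc (n ∸ k) + t₀) ≡ (A , ∣A∣≡k)
      A-window = k ∸ suc ∣YA∣ , ∸-monoʳ-< (s≤s z≤n) ∣YA∣<k , trans (cong window start≡s₀) window-s₀
        where
        start≡s₀ : suc (n ∸ k) + (k ∸ suc ∣YA∣) ≡ s₀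
        start≡s₀ = +-cancelʳ-≡ ∣YA∣ _ _ (begin
          suc (n ∸ k) + (k ∸ suc ∣YA∣) + ∣YA∣   ≡⟨ rearrange (n ∸ k) (k ∸ suc ∣YA∣) ∣YA∣ ⟩
          n ∸ k + (k ∸ suc ∣YA∣ + suc ∣YA∣)     ≡⟨ cong (n ∸ k +_) (m∸n+n≡m ∣YA∣<k) ⟩
          n ∸ k + k                             ≡⟨ m∸n+n≡m (<⇒≤ k<n) ⟩
          n                                     ≡⟨ s₀+∣YA∣≡n ⟨
          s₀ + ∣YA∣                             ∎)
          where
          open ≡-Reasoning
          rearrange : ∀ a b c → suc a + b + c ≡ a + (b + suc c)
          rearrange = solve-∀

-- Colourings of Kneser graphs

run-cases : ∀ {n k b} → 2 ≤ k → k + k < n → b < n →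
            (∃[ t ] t < k × (b + t ≡ 1 ⊎ b + t ≡ n + 1))
          ⊎ (∃[ t ] t < k × k < b + t × b + t + k ≤ n)
          ⊎ b ≡ suc (n ∸ k)
run-cases {n} {k} {b} 2≤k 2k<n b<n with b ≤? 1
... | yes b≤1 = inj₁ (1 ∸ b , ≤-<-trans (m∸n≤m 1 b) 2≤k , inj₁ (m+[n∸m]≡n b≤1))
... | no b≰1 with b ≤? k
...   | yes b≤k = inj₂ (inj₁ (suc k ∸ b , ∸-monoʳ-< (≰⇒> b≰1) (m≤n⇒m≤1+n b≤k) ,
                        subst (k <_) (sym b+t≡1+k) ≤-refl , subst (λ u → u + k ≤ n) (sym b+t≡1+k) 2k<n))
  where
  b+t≡1+k : b + (suc k ∸ b) ≡ suc k
  b+t≡1+k = m+[n∸m]≡n (m≤n⇒m≤1+n b≤k)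
...   | no b≰k with b + k ≤? n
...     | yes b+k≤n = inj₂ (inj₁ (0 , ≤-trans (s≤s z≤n) 2≤k , subst (k <_) (sym (+-identityʳ b)) (≰⇒> b≰k) ,
                          subst (λ u → u + k ≤ n) (sym (+-identityʳ b)) b+k≤n))
...     | no b+k≰n with b ≟ suc (n ∸ k)
...       | yes b≡ = inj₂ (inj₂ b≡)
...       | no b≢ = inj₁ (suc n ∸ b , t<k , inj₂ (trans (m+[n∸m]≡n b≤1+n) (+-comm 1 n)))
  where
  k≤n : k ≤ n
  k≤n = ≤-trans (m≤n+m k k) (<⇒≤ 2k<n)
  b≤1+n : b ≤ suc n
  b≤1+n = m≤n⇒m≤1+n (<⇒≤ b<n)
  n∸k<b : n ∸ k < b
  n∸k<b = +-cancelʳ-< k (n ∸ k) b (subst (_< b + k) (sym (m∸n+n≡m k≤n)) (≰⇒> b+k≰n))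
  t<k : suc n ∸ b < k
  t<k = subst (suc n ∸ b <_) (m∸[m∸n]≡n k≤n) (∸-monoʳ-< (≤∧≢⇒< n∸k<b (b≢ ∘ sym)) b≤1+n)

module StarColours {n k m j r : ℕ} ⦃ _ : NonZero n ⦄ (2≤k : 2 ≤ k) (2k<n : k + k < n)
  (c : KVertex n k → KSubset m j) (c-proper : ∀ u v → KAdj u v → Disjoint (proj₁ (c u)) (proj₁ (c v)))
  (few-colours : m * k ≤ n * j + n * r) where

  private
    k<n : k < n
    k<n = ≤-<-trans (m≤m+n k k) 2k<n

    1≤k : 1 ≤ k
    1≤k = ≤-trans (s≤s z≤n) 2≤k

  _∈c_ : Fin m → KVertex n k → Set
  x ∈c v = x ∈ proj₁ (c v)

  _∈c?_ : (x : Fin m) (v : KVertex n k) → Dec (x ∈c v)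
  x ∈c? v = x ∈? proj₁ (c v)

  colours : ∀ v → ∑[ x < m ] 𝟙 (x ∈c? v) ≡ j
  colours v = trans (sym (∣p∣≡∑𝟙∈ (proj₁ (c v)))) (proj₂ (c v))

  no-colour-on-disjoint : ∀ {x u v} → Disjoint (proj₁ u) (proj₁ v) → x ∈c u → x ∈c v → ⊥
  no-colour-on-disjoint {x} {u} {v} u∩v≡∅ x∈u x∈v = c-proper u v u∩v≡∅ x x∈u x∈v

  module Circle (o : CyclicOrder n) (x : Fin m) where

    open Windows o (<⇒≤ k<n) public

    P : ℕ → ℕ
    P s = 𝟙 (x ∈c? window s)

    open Katona 2k<n P (λ s → 𝟙≤1 (x ∈c? window s))
      (λ s → cong (λ v → 𝟙 (x ∈c? v)) (window-cong-% (s + n) s ([m+n]%n≡m%n s n)))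
      (λ s d k≤d d+k≤n → 𝟙-exclusive (x ∈c? window s) (x ∈c? window (s + d)) (no-colour-on-disjoint (window-far s k≤d d+k≤n)))
      public

    full⇒∈c-run : k ≤ count → ∃[ b ] (∀ t → t < k → x ∈c window (b + t))
    full⇒∈c-run k≤count = let (b , run) = full⇒run k≤count in
      b , λ t t<k → 𝟙-positive (x ∈c? window (b + t)) (≤-reflexive (sym (run t t<k)))

  deficiency : CyclicOrder n → Fin m → ℕ
  deficiency o x = k ∸ Circle.count o x

  ∑-count : ∀ o → ∑[ x < m ] Circle.count o x ≡ n * j
  ∑-count o = begin
    ∑[ x < m ] ∑[ s < n ] 𝟙 (x ∈c? window (toℕ s))  ≡⟨ ∑-comm {m} {n} (λ x (s : Fin n) → 𝟙 (x ∈c? window (toℕ s))) ⟩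
    ∑[ s < n ] ∑[ x < m ] 𝟙 (x ∈c? window (toℕ s))  ≡⟨ sum-cong-≗ {n} (λ s → colours (window (toℕ s))) ⟩
    ∑[ s < n ] j                                    ≡⟨ sum-const n j ⟩
    n * j                                           ∎
    where
    open ≡-Reasoning
    open Windows o (<⇒≤ k<n)

  ∑-deficiency≤ : ∀ o → ∑[ x < m ] deficiency o x ≤ n * r
  ∑-deficiency≤ o = +-cancelʳ-≤ (n * j) _ _ (begin
    ∑[ x < m ] deficiency o x + n * j                                  ≡⟨ cong (∑[ x < m ] deficiency o x +_) (∑-count o) ⟨
    ∑[ x < m ] deficiency o x + ∑[ x < m ] Circle.count o x            ≡⟨ ∑-distrib-+ (deficiency o) (Circle.count o) ⟨
    ∑[ x < m ] (deficiency o x + Circle.count o x)                     ≡⟨ sum-cong-≗ {m} (λ x → m∸n+n≡m (Circle.count≤k o x)) ⟩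
    ∑[ x < m ] k                                                       ≡⟨ sum-const m k ⟩
    m * k                                                              ≤⟨ few-colours ⟩
    n * j + n * r                                                      ≡⟨ +-comm (n * j) (n * r) ⟩
    n * r + n * j                                                      ∎)
    where open ≤-Reasoning

  adaptedOrder : Fin n → Subset n → CyclicOrder n
  adaptedOrder = AdaptedOrder.order k<n

  private
    full-of-deficiency≡0 : ∀ o x → deficiency o x ≡ 0 → ∃[ b ] (∀ t → t < k → x ∈c Windows.window o (<⇒≤ k<n) (b + t))
    full-of-deficiency≡0 o x d≡0 = Circle.full⇒∈c-run o x (m∸n≡0⇒m≤n d≡0)

  opaque
    -- The orders tested are the identity order and one adapted order for each y and A; their
    -- number, 1 + n 2ⁿ, does not depend on m or j.
    defect : Fin m → ℕ
    defect x = deficiency identityOrder x + ∑[ y < n ] ∑-subsets (λ A → deficiency (adaptedOrder y A) x)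

    ∑-defect≤ : ∑[ x < m ] defect x ≤ n * r + n * (2 ^ n * (n * r))
    ∑-defect≤ = begin
      ∑[ x < m ] defect x
        ≡⟨ ∑-distrib-+ (deficiency identityOrder) _ ⟩
      ∑[ x < m ] deficiency identityOrder x + ∑[ x < m ] ∑[ y < n ] ∑-subsets (λ A → deficiency (adaptedOrder y A) x)
        ≡⟨ cong (∑[ x < m ] deficiency identityOrder x +_) (∑-comm {m} {n} (λ x y → ∑-subsets (λ A → deficiency (adaptedOrder y A) x))) ⟩
      ∑[ x < m ] deficiency identityOrder x + ∑[ y < n ] ∑[ x < m ] ∑-subsets (λ A → deficiency (adaptedOrder y A) x)
        ≡⟨ cong (∑[ x < m ] deficiency identityOrder x +_) (sum-cong-≗ {n} (λ y → ∑-∑-subsets-comm (λ x A → deficiency (adaptedOrder y A) x))) ⟩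
      ∑[ x < m ] deficiency identityOrder x + ∑[ y < n ] ∑-subsets (λ A → ∑[ x < m ] deficiency (adaptedOrder y A) x)
        ≤⟨ +-mono-≤ (∑-deficiency≤ identityOrder) (sum-mono-≤ {n} (λ y → ∑-subsets-mono-≤ (λ A → ∑-deficiency≤ (adaptedOrder y A)))) ⟩
      n * r + ∑[ y < n ] ∑-subsets {n} (λ _ → n * r)
        ≡⟨ cong (n * r +_) (trans (sum-cong-≗ {n} (λ _ → ∑-subsets-const n (n * r))) (sum-const n _)) ⟩
      n * r + n * (2 ^ n * (n * r))
        ∎
      where open ≤-Reasoning

    good⇒identity-run : ∀ {x} → defect x ≡ 0 → ∃[ b ] (∀ t → t < k → x ∈c Windows.window identityOrder (<⇒≤ k<n) (b + t))
    good⇒identity-run {x} good = full-of-deficiency≡0 identityOrder x (n≤0⇒n≡0 (≤-trans (m≤m+n _ _) (≤-reflexive good)))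

    good⇒adapted-run : ∀ {x} → defect x ≡ 0 → ∀ y A → ∃[ b ] (∀ t → t < k → x ∈c Windows.window (adaptedOrder y A) (<⇒≤ k<n) (b + t))
    good⇒adapted-run {x} good y A = full-of-deficiency≡0 (adaptedOrder y A) x (n≤0⇒n≡0 (begin
      deficiency (adaptedOrder y A) x                                       ≤⟨ term≤∑-subsets (λ A → deficiency (adaptedOrder y A) x) A ⟩
      ∑-subsets (λ A → deficiency (adaptedOrder y A) x)                     ≤⟨ term≤sum (λ y → ∑-subsets (λ A → deficiency (adaptedOrder y A) x)) y ⟩
      ∑[ y < n ] ∑-subsets (λ A → deficiency (adaptedOrder y A) x)          ≤⟨ m≤n+m _ (deficiency identityOrder x) ⟩
      defect x                                                              ≡⟨ good ⟩
      0                                                                     ∎))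
      where open ≤-Reasoning

  Good : Fin m → Set
  Good x = defect x ≡ 0

  totalDefect : ℕ
  totalDefect = ∑[ x < m ] defect x

  totalDefect≤ : totalDefect ≤ n * r + n * (2 ^ n * (n * r))
  totalDefect≤ = ∑-defect≤

  open Windows identityOrder (<⇒≤ k<n) using () renaming
    (window to E; ∈-window⁻ to ∈-E⁻; window-cong-% to E-cong-%)

  -- E (toℕ y) and E′ y are the windows of the identity order that start and end at y.
  E′ : Fin n → KVertex n k
  E′ y = E (toℕ y + suc (n ∸ k))

  Centred : Fin n → Fin m → Set
  Centred y x = Good x × x ∈c E (toℕ y) × x ∈c E′ y

  centred? : ∀ y x → Dec (Centred y x)
  centred? y x = (defect x ≟ 0) ×-dec (x ∈c? E (toℕ y)) ×-dec (x ∈c? E′ y)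



  wrap-around : ∀ b → b + (k ∸ 1) + suc (n ∸ k) ≡ b + n
  wrap-around b = begin
      b + (k ∸ 1) + suc (n ∸ k)   ≡⟨ +-assoc b (k ∸ 1) (suc (n ∸ k)) ⟩
      b + (k ∸ 1 + suc (n ∸ k))   ≡⟨ cong (b +_) (+-suc (k ∸ 1) (n ∸ k)) ⟩
      b + (suc (k ∸ 1) + (n ∸ k)) ≡⟨ cong (λ u → b + (u + (n ∸ k))) (m+[n∸m]≡n 1≤k) ⟩
      b + (k + (n ∸ k))           ≡⟨ cong (b +_) (m+[n∸m]≡n (<⇒≤ k<n)) ⟩
      b + n                       ∎
      where open ≡-Reasoning

  module _ {x : Fin m} (b : ℕ) (run : ∀ t → t < k → x ∈c E (b + t)) where

    private
      y% : toℕ ((b + (k ∸ 1)) mod n) % n ≡ (b + (k ∸ 1)) % n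
      y% = trans (cong (_% n) (toℕ-mod (b + (k ∸ 1)))) (m%n%n≡m%n (b + (k ∸ 1)) n)

    run⇒∈E : x ∈c E (toℕ ((b + (k ∸ 1)) mod n))
    run⇒∈E = subst (x ∈c_) (E-cong-% (b + (k ∸ 1)) (toℕ ((b + (k ∸ 1)) mod n)) (sym y%)) (run (k ∸ 1) (∸-monoʳ-< (s≤s z≤n) 1≤k))

    run⇒∈E′ : x ∈c E′ ((b + (k ∸ 1)) mod n)
    run⇒∈E′ = subst (x ∈c_) (E-cong-% (b + 0) (toℕ ((b + (k ∸ 1)) mod n) + suc (n ∸ k)) (begin
      (b + 0) % n                                         ≡⟨ cong (_% n) (+-identityʳ b) ⟩
      b % n                                               ≡⟨ [m+n]%n≡m%n b n ⟨
      (b + n) % n                                         ≡⟨ cong (_% n) (wrap-around b) ⟨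
      (b + (k ∸ 1) + suc (n ∸ k)) % n                     ≡⟨ +-cong-% {n} (toℕ ((b + (k ∸ 1)) mod n)) (b + (k ∸ 1)) (suc (n ∸ k)) y% ⟨
      (toℕ ((b + (k ∸ 1)) mod n) + suc (n ∸ k)) % n       ∎)) (run 0 (≤-trans (s≤s z≤n) 2≤k))
      where open ≡-Reasoning

  good⇒centred : ∀ {x} → Good x → ∃[ y ] Centred y x
  good⇒centred good = let (b , run) = good⇒identity-run good in
    (b + (k ∸ 1)) mod n , good , run⇒∈E b run , run⇒∈E′ b run

  module Adapted (y : Fin n) (A : Subset n) = Windows (adaptedOrder y A) (<⇒≤ k<n)

  private
    k<1+n∸k : k < suc (n ∸ k)
    k<1+n∸k = s≤s (+-cancelʳ-≤ k k (n ∸ k) (≤-trans (<⇒≤ 2k<n) (≤-reflexive (sym (m∸n+n≡m (<⇒≤ k<n))))))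

  adapted-1-disjoint : ∀ y A → Disjoint (proj₁ (Adapted.window y A 1)) (proj₁ (E′ y))
  adapted-1-disjoint y A z z∈W z∈E′ with Adapted.∈-window⁻ y A 1 z∈W | ∈-E⁻ (toℕ y + suc (n ∸ k)) z∈E′
  ... | t , t<k , refl | t′ , t′<k , eq′ = let (u , u<k , eq) = AdaptedOrder.at-early k<n y A t<k in
    ⊕-distinct y (≤-<-trans u<k (≤-trans k<1+n∸k (m≤m+n _ t′))) (≤-<-trans N1+t′≤n (m<n+m n (s≤s z≤n)))
      (trans (sym eq) (trans (sym eq′) (cong (_mod n) (+-assoc (toℕ y) (suc (n ∸ k)) t′))))
    where
    N1+t′≤n : suc (n ∸ k) + t′ ≤ n
    N1+t′≤n = ≤-trans (≤-reflexive (sym (+-suc (n ∸ k) t′))) (≤-trans (+-monoʳ-≤ (n ∸ k) t′<k) (≤-reflexive (m∸n+n≡m (<⇒≤ k<n))))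

  adapted-middle-disjoint : ∀ y A s → k < s → s + k ≤ n → Disjoint (proj₁ (Adapted.window y A s)) (proj₁ (E (toℕ y)))
  adapted-middle-disjoint y A s k<s s+k≤n z z∈W z∈E with Adapted.∈-window⁻ y A s z∈W | ∈-E⁻ (toℕ y) z∈E
  ... | t , t<k , refl | t′ , t′<k , eq′ =
    let (u , k<u , u<n , eq) = AdaptedOrder.at-late k<n y A (<-≤-trans k<s (m≤m+n s t)) (<-≤-trans (+-monoʳ-< s t<k) s+k≤n) in
    ⊕-distinct y (<-trans t′<k k<u) (<-≤-trans u<n (m≤n+m n t′)) (trans eq′ eq)

  module _ {y : Fin n} {x : Fin m} (∈E : x ∈c E (toℕ y)) (∈E′ : x ∈c E′ y) (v : KVertex n k) (y∈v : y ∈ proj₁ v) where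

    private
      A = proj₁ v
      W = Adapted.window y A

      W-% : ∀ b t → W (b % n + t) ≡ W (b + t)
      W-% b t = Adapted.window-cong-% y A (b % n + t) (b + t) (+-cong-% (b % n) b t (m%n%n≡m%n b n))

      W-n+1 : W (n + 1) ≡ W 1
      W-n+1 = Adapted.window-cong-% y A (n + 1) 1 (trans (cong (_% n) (+-comm n 1)) ([m+n]%n≡m%n 1 n))

    -- Window 1 of the adapted order misses E′ y and windows k + 1, …, n − k miss E (toℕ y),
    -- so a run of k windows containing x must start at n − k + 1 and then passes the window v.
    adapted-run⇒∈c : ∀ b → (∀ t → t < k → x ∈c W (b + t)) → x ∈c v
    adapted-run⇒∈c b run with run-cases {n} {k} {b % n} 2≤k 2k<n (m%n<n b n)
    ... | inj₁ (t , t<k , inj₁ b′+t≡1) =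
      ⊥-elim (no-colour-on-disjoint (adapted-1-disjoint y A) (subst (x ∈c_) (trans (sym (W-% b t)) (cong W b′+t≡1)) (run t t<k)) ∈E′)
    ... | inj₁ (t , t<k , inj₂ b′+t≡n+1) =
      ⊥-elim (no-colour-on-disjoint (adapted-1-disjoint y A) (subst (x ∈c_) (trans (sym (W-% b t)) (trans (cong W b′+t≡n+1) W-n+1)) (run t t<k)) ∈E′)
    ... | inj₂ (inj₁ (t , t<k , k<s , s+k≤n)) =
      ⊥-elim (no-colour-on-disjoint (adapted-middle-disjoint y A (b % n + t) k<s s+k≤n) (subst (x ∈c_) (sym (W-% b t)) (run t t<k)) ∈E)
    ... | inj₂ (inj₂ b′≡N1) = let (t₀ , t₀<k , W≡v) = AdaptedOrder.A-window k<n y A (proj₂ v) y∈v in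
      subst (x ∈c_) (trans (sym (W-% b t₀)) (trans (cong (λ s → W (s + t₀)) b′≡N1) W≡v)) (run t₀ t₀<k)

  centred⇒star : ∀ {y x} → Centred y x → ∀ v → y ∈ proj₁ v → x ∈c v
  centred⇒star {y} (good , ∈E , ∈E′) v y∈v =
    let (b , run) = good⇒adapted-run good y (proj₁ v) in adapted-run⇒∈c ∈E ∈E′ v y∈v b run

  centred⇒class : ∀ {y x} → Centred y x → ∀ v → x ∈c v → y ∈ proj₁ v
  centred⇒class {y} centred v x∈v with y ∈? proj₁ v
  ... | yes y∈v = y∈v
  ... | no y∉v = let (B , y∈B , B∩v≡∅) = k-set-through (proj₁ v) y∉v ∣v∣+k≤n 1≤k in
    ⊥-elim (no-colour-on-disjoint B∩v≡∅ (centred⇒star centred B y∈B) x∈v)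
    where
    ∣v∣+k≤n : ∣ proj₁ v ∣ + k ≤ n
    ∣v∣+k≤n = subst (λ u → u + k ≤ n) (sym (proj₂ v)) (<⇒≤ 2k<n)

  centred-unique : ∀ {y y′ x} → Centred y x → Centred y′ x → y ≡ y′
  centred-unique {y} {y′} centred centred′ with y ≟ᶠ y′
  ... | yes y≡y′ = y≡y′
  ... | no y≢y′ = let (B , y∈B , B∩⁅y′⁆≡∅) = k-set-through ⁅ y′ ⁆ (y≢y′ ∘ x∈⁅y⁆⇒x≡y y′) 1+k≤n 1≤k in
    ⊥-elim (B∩⁅y′⁆≡∅ y′ (centred⇒class centred′ B (centred⇒star centred B y∈B)) (x∈⁅x⁆ y′))
    where
    1+k≤n : ∣ ⁅ y′ ⁆ ∣ + k ≤ n
    1+k≤n = subst (λ u → u + k ≤ n) (sym (∣⁅x⁆∣≡1 y′)) k<n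

  centres : Fin n → ℕ
  centres y = ∑[ x < m ] 𝟙 (centred? y x)

  private
    weight : Subset n → Fin m → Fin n → ℕ
    weight p x y = 𝟙 (y ∈? p) * 𝟙 (centred? y x)

    ∑∈-centres : ∀ p → ∑∈ p centres ≡ ∑[ x < m ] ∑[ y < n ] weight p x y
    ∑∈-centres p = trans (sum-cong-≗ {n} (λ y → *-distribˡ-sum (𝟙 (y ∈? p)) (λ x → 𝟙 (centred? y x))))
                         (∑-comm {n} {m} (λ y x → weight p x y))


    ∑-𝟙-centred≤1 : ∀ x → ∑[ y < n ] 𝟙 (centred? y x) ≤ 1
    ∑-𝟙-centred≤1 x with any? (λ y → centred? y x)
    ... | no none = ≤-trans (≤-reflexive (sum-zero (λ y → 𝟙 (centred? y x)) (λ y → 𝟙-no (centred? y x) (λ c → none (y , c))))) z≤n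
    ... | yes (y₀ , centred₀) = ≤-trans (≤-reflexive (sum-single (λ y → 𝟙 (centred? y x)) y₀ others)) (𝟙≤1 (centred? y₀ x))
      where
      others : ∀ y → y ≢ y₀ → 𝟙 (centred? y x) ≡ 0
      others y y≢y₀ = 𝟙-no (centred? y x) (λ c → y≢y₀ (centred-unique c centred₀))

  centres-upper : ∀ v → ∑∈ (proj₁ v) centres ≤ j
  centres-upper v = begin
    ∑∈ (proj₁ v) centres                          ≡⟨ ∑∈-centres (proj₁ v) ⟩
    ∑[ x < m ] ∑[ y < n ] weight (proj₁ v) x y    ≤⟨ sum-mono-≤ {m} pointwise ⟩
    ∑[ x < m ] 𝟙 (x ∈c? v)                        ≡⟨ colours v ⟩
    j                                             ∎
    where
    open ≤-Reasoning
    pointwise : ∀ x → ∑[ y < n ] weight (proj₁ v) x y ≤ 𝟙 (x ∈c? v)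
    pointwise x with x ∈c? v
    ... | yes _ = ≤-trans (sum-mono-≤ {n} term≤) (∑-𝟙-centred≤1 x)
      where
      term≤ : ∀ y → weight (proj₁ v) x y ≤ 𝟙 (centred? y x)
      term≤ y = ≤-trans (*-monoˡ-≤ (𝟙 (centred? y x)) (𝟙≤1 (y ∈? proj₁ v))) (≤-reflexive (+-identityʳ (𝟙 (centred? y x))))
    ... | no x∉v = ≤-reflexive (sum-zero (weight (proj₁ v) x) term≡0)
      where
      term≡0 : ∀ y → weight (proj₁ v) x y ≡ 0
      term≡0 y with y ∈? proj₁ v
      ... | yes y∈v = trans (+-identityʳ (𝟙 (centred? y x))) (𝟙-no (centred? y x) (λ c → x∉v (centred⇒star c v y∈v)))
      ... | no _ = refl

  centres-lower : ∀ v → j ≤ totalDefect + ∑∈ (proj₁ v) centres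
  centres-lower v = begin
    j                                                           ≡⟨ colours v ⟨
    ∑[ x < m ] 𝟙 (x ∈c? v)                                      ≤⟨ sum-mono-≤ {m} pointwise ⟩
    ∑[ x < m ] (defect x + ∑[ y < n ] weight (proj₁ v) x y)     ≡⟨ ∑-distrib-+ defect (λ x → ∑[ y < n ] weight (proj₁ v) x y) ⟩
    totalDefect + ∑[ x < m ] ∑[ y < n ] weight (proj₁ v) x y    ≡⟨ cong (totalDefect +_) (∑∈-centres (proj₁ v)) ⟨
    totalDefect + ∑∈ (proj₁ v) centres                          ∎
    where
    open ≤-Reasoning
    pointwise : ∀ x → 𝟙 (x ∈c? v) ≤ defect x + ∑[ y < n ] weight (proj₁ v) x y
    pointwise x with x ∈c? v | defect x ≟ 0
    ... | no _ | _ = z≤n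
    ... | yes _ | no defect≢0 = ≤-trans (n≢0⇒n>0 defect≢0) (m≤m+n (defect x) (∑[ y < n ] weight (proj₁ v) x y))
    ... | yes x∈v | yes good = let (y₀ , centred₀) = good⇒centred good in begin
      1                                     ≡⟨ cong₂ _*_ (𝟙-yes (y₀ ∈? proj₁ v) (centred⇒class centred₀ v x∈v)) (𝟙-yes (centred? y₀ x) centred₀) ⟨
      weight (proj₁ v) x y₀                 ≤⟨ term≤sum (weight (proj₁ v) x) y₀ ⟩
      ∑[ y < n ] weight (proj₁ v) x y       ≤⟨ m≤n+m (∑[ y < n ] weight (proj₁ v) x y) (defect x) ⟩
      defect x + ∑[ y < n ] weight (proj₁ v) x y ∎

  -- If y₀ centres no colour, exchanging y₀ for u in a k-set through y₀ avoiding u bounds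
  -- centres u by totalDefect, for every u; then j ≤ (1 + k) totalDefect.
  every-point-is-a-centre : suc k * totalDefect < j → ∀ y → 0 < centres y
  every-point-is-a-centre big y₀ with centres y₀ ≟ 0
  ... | no centres≢0 = n≢0⇒n>0 centres≢0
  ... | yes centres≡0 = contradiction j≤ (<⇒≱ big)
    where
    D = totalDefect

    centres≤D : ∀ u → centres u ≤ D
    centres≤D u with u ≟ᶠ y₀
    ... | yes refl = ≤-trans (≤-reflexive centres≡0) z≤n
    ... | no u≢y₀ = +-cancelˡ-≤ (∑∈ A centres) (centres u) D (begin
      ∑∈ A centres + centres u          ≡⟨ ∑∈-exchange y₀∈A u∉A centres ⟨
      ∑∈ A′ centres + centres y₀        ≡⟨ cong (∑∈ A′ centres +_) centres≡0 ⟩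
      ∑∈ A′ centres + 0                 ≡⟨ +-identityʳ (∑∈ A′ centres) ⟩
      ∑∈ A′ centres                     ≤⟨ centres-upper (A′ , trans (∣exchange∣ y₀∈A u∉A) (proj₂ vertex)) ⟩
      j                                 ≤⟨ centres-lower vertex ⟩
      D + ∑∈ A centres                  ≡⟨ +-comm D (∑∈ A centres) ⟩
      ∑∈ A centres + D                  ∎)
      where
      open ≤-Reasoning
      through = k-set-through ⁅ u ⁆ (u≢y₀ ∘ sym ∘ x∈⁅y⁆⇒x≡y u) (subst (λ s → s + k ≤ n) (sym (∣⁅x⁆∣≡1 u)) k<n) 1≤k
      vertex = proj₁ through
      A = proj₁ vertex
      y₀∈A = proj₁ (proj₂ through)
      u∉A : u ∉ A
      u∉A u∈A = proj₂ (proj₂ through) u u∈A (x∈⁅x⁆ u)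
      A′ = exchange y₀ u A

    j≤ : j ≤ suc k * D
    j≤ = begin
      j                                   ≤⟨ centres-lower (E 0) ⟩
      D + ∑∈ (proj₁ (E 0)) centres        ≤⟨ +-monoʳ-≤ D (∑∈-mono-≤ (proj₁ (E 0)) (λ u _ → centres≤D u)) ⟩
      D + ∑∈ (proj₁ (E 0)) (λ _ → D)      ≡⟨ cong (D +_) (trans (∑∈-const (proj₁ (E 0)) D) (cong (_* D) (proj₂ (E 0)))) ⟩
      D + k * D                           ∎
      where open ≤-Reasoning

  module _ (big : suc k * totalDefect < j) where

    private
      centre-colour : ∀ y → ∃[ x ] Centred y x
      centre-colour y = let (x , 0<) = positive-term (λ x → 𝟙 (centred? y x)) (every-point-is-a-centre big y) in
        x , 𝟙-positive (centred? y x) 0<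

      σ : Fin n → Fin m
      σ y = proj₁ (centre-colour y)

      σ-injective : Injective _≡_ _≡_ σ
      σ-injective {y} {y′} σy≡σy′ = centred-unique (proj₂ (centre-colour y)) (subst (Centred y′) (sym σy≡σy′) (proj₂ (centre-colour y′)))

      stars-meet-each-vertex-k-times : ∀ v → ∑∈ (image σ) (λ x → 𝟙 (x ∈c? v)) ≡ k
      stars-meet-each-vertex-k-times v = begin
        ∑∈ (image σ) (λ x → 𝟙 (x ∈c? v))   ≡⟨ ∑∈-image σ σ-injective (λ x → 𝟙 (x ∈c? v)) ⟩
        ∑[ y < n ] 𝟙 (σ y ∈c? v)           ≡⟨ sum-cong-≗ {n} (λ y → 𝟙-cong (σ y ∈c? v) (y ∈? proj₁ v)
                                                (centred⇒class (proj₂ (centre-colour y)) v) (centred⇒star (proj₂ (centre-colour y)) v)) ⟩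
        ∑[ y < n ] 𝟙 (y ∈? proj₁ v)        ≡⟨ ∣p∣≡∑𝟙∈ (proj₁ v) ⟨
        ∣ proj₁ v ∣                        ≡⟨ proj₂ v ⟩
        k                                  ∎
        where open ≡-Reasoning

    remove-star-colours : Colourable (KVertex n k) KAdj (m ∸ n) (j ∸ k) × n ≤ m
    remove-star-colours =
      subst (λ s → Colourable (KVertex n k) KAdj (m ∸ s) (j ∸ k)) (∣image∣ σ σ-injective)
            (delete-colours (image σ) c c-proper stars-meet-each-vertex-k-times) ,
      subst (_≤ m) (∣image∣ σ σ-injective) (∣p∣≤n (image σ))

m+1≤q⇒m<q*k∸r : ∀ {B q k r} → 1 ≤ k → B + 1 ≤ q → r < k → B < q * k ∸ r
m+1≤q⇒m<q*k∸r {B} {q} {k} {r} 1≤k B+1≤q r<k = +-cancelʳ-< r B (q * k ∸ r) (begin-strict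
  B + r           ≤⟨ +-monoˡ-≤ r (m≤m*n B k ⦃ >-nonZero 1≤k ⦄) ⟩
  B * k + r       <⟨ +-monoʳ-< (B * k) r<k ⟩
  B * k + k       ≤⟨ B*k+k≤q*k ⟩
  q * k           ≡⟨ m∸n+n≡m (≤-trans (<⇒≤ r<k) (≤-trans (m≤n+m k (B * k)) B*k+k≤q*k)) ⟨
  q * k ∸ r + r   ∎)
  where
  open ≤-Reasoning
  B*k+k≤q*k : B * k + k ≤ q * k
  B*k+k≤q*k = ≤-trans (≤-reflexive (trans (+-comm (B * k) k) (cong (_* k) (+-comm 1 B)))) (*-monoˡ-≤ k B+1≤q)

defectBound : ℕ → ℕ → ℕ
defectBound n r = n * r + n * (2 ^ n * (n * r))

defectBound-mono : ∀ n {r r′} → r ≤ r′ → defectBound n r ≤ defectBound n r′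
defectBound-mono n r≤r′ = +-mono-≤ (*-monoʳ-≤ n r≤r′) (*-monoʳ-≤ n (*-monoʳ-≤ (2 ^ n) (*-monoʳ-≤ n r≤r′)))

multichromatic≤ : ∀ {n k q j χ} → IsMultiChromatic (KVertex n k) KAdj j χ → j ≤ q * k → χ ≤ q * n
multichromatic≤ {q = q} (_ , minimal) j≤qk = minimal _ (shrink-colouring j≤qk (blow-up q ((λ v → v) , λ u v uv → uv)))

colour-budget : ∀ {n k q r χ} → χ ≤ q * n → r ≤ q * k → χ * k ≤ n * (q * k ∸ r) + n * r
colour-budget {n} {k} {q} {r} {χ} χ≤qn r≤qk = begin
  χ * k                       ≤⟨ *-monoˡ-≤ k χ≤qn ⟩
  q * n * k                   ≡⟨ rearrange q n k ⟩
  n * (q * k)                 ≡⟨ cong (n *_) (m∸n+n≡m r≤qk) ⟨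
  n * (q * k ∸ r + r)         ≡⟨ *-distribˡ-+ n (q * k ∸ r) r ⟩
  n * (q * k ∸ r) + n * r     ∎
  where
  open ≤-Reasoning
  rearrange : ∀ q n k → q * n * k ≡ n * (q * k)
  rearrange = solve-∀

q*k∸r∸k≡[q∸1]*k∸r : ∀ q k r → q * k ∸ r ∸ k ≡ (q ∸ 1) * k ∸ r
q*k∸r∸k≡[q∸1]*k∸r q k r = begin
  q * k ∸ r ∸ k        ≡⟨ ∸-+-assoc (q * k) r k ⟩
  q * k ∸ (r + k)      ≡⟨ cong (q * k ∸_) (+-comm r k) ⟩
  q * k ∸ (k + r)      ≡⟨ ∸-+-assoc (q * k) k r ⟨
  q * k ∸ k ∸ r        ≡⟨ cong (λ u → q * k ∸ u ∸ r) (*-identityˡ k) ⟨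
  q * k ∸ 1 * k ∸ r    ≡⟨ cong (_∸ r) (*-distribʳ-∸ k q 1) ⟨
  (q ∸ 1) * k ∸ r      ∎
  where open ≡-Reasoning

multichromatic-step : ∀ {n k q r χ₁ χ₂} ⦃ _ : NonZero n ⦄ → 2 ≤ k → k + k < n → r < k →
                      suc k * defectBound n k < q * k ∸ r →
                      IsMultiChromatic (KVertex n k) KAdj (q * k ∸ r) χ₁ →
                      IsMultiChromatic (KVertex n k) KAdj ((q ∸ 1) * k ∸ r) χ₂ →
                      n + χ₂ ≤ χ₁
multichromatic-step {n} {k} {q} {r} {χ₁} {χ₂} 2≤k 2k<n r<k big χ₁-is@((c , proper) , _) (_ , χ₂-minimal) = begin
  n + χ₂          ≤⟨ +-monoʳ-≤ n (χ₂-minimal (χ₁ ∸ n) (subst (Colourable (KVertex n k) KAdj (χ₁ ∸ n)) j∸k≡ fewer)) ⟩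
  n + (χ₁ ∸ n)    ≡⟨ m+[n∸m]≡n n≤χ₁ ⟩
  χ₁              ∎
  where
  open ≤-Reasoning
  r≤qk : r ≤ q * k
  r≤qk = ≮⇒≥ (λ qk<r → <⇒≢ (≤-<-trans z≤n big) (sym (m≤n⇒m∸n≡0 (<⇒≤ qk<r))))

  open StarColours {r = r} 2≤k 2k<n c proper (colour-budget {n} {k} {q} (multichromatic≤ {q = q} χ₁-is (m∸n≤m (q * k) r)) r≤qk)
    using (totalDefect≤; remove-star-colours)

  stars-removed = remove-star-colours (≤-<-trans (*-monoʳ-≤ (suc k) (≤-trans totalDefect≤ (defectBound-mono n (<⇒≤ r<k)))) big)
  fewer = proj₁ stars-removed
  n≤χ₁ = proj₂ stars-removed
  j∸k≡ = q*k∸r∸k≡[q∸1]*k∸r q k r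

lemma3p3 : (n k : ℕ) → 2 ≤ k → 2 * k + 1 ≤ n →
    Σ ℕ (λ q₀ → (q r : ℕ) → q₀ + 1 ≤ q → r < k →
      (χ₁ χ₂ : ℕ) →
      IsMultiChromatic (KVertex n k) KAdj (q * k ∸ r) χ₁ →
      IsMultiChromatic (KVertex n k) KAdj ((q ∸ 1) * k ∸ r) χ₂ →
      n + χ₂ ≤ χ₁)
lemma3p3 n k 2≤k 2k+1≤n = suc k * defectBound n k , λ q r q₀+1≤q r<k χ₁ χ₂ →
  multichromatic-step {q = q} ⦃ >-nonZero (≤-<-trans z≤n 2k<n) ⦄ 2≤k 2k<n r<k (m+1≤q⇒m<q*k∸r (≤-trans (s≤s z≤n) 2≤k) q₀+1≤q r<k)
  where
  2k<n : k + k < n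
  2k<n = subst (_≤ n) (2k+1≡ k) 2k+1≤n
    where
    2k+1≡ : ∀ k → 2 * k + 1 ≡ suc (k + k)
    2k+1≡ = solve-∀
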